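{- For all integers $k,t\ge 0$ and $p,q,r,s\ge 1$, $\beta(k,p,q,r,s,t)>0$.
   Context: All matrices are over $\mathbb{F}_2$. For integers $d\ge1$, $t_0,t_d\ge0$, $t_1,\dots,t_{d-1}\ge1$, let $m=t_0+\cdots+t_d+1$ and let $\Gamma(t_0,\dots,t_d)$ be the graph with vertices $x,x_1,\dots,x_m$, path edges $x_ix_{i+1}$ ($1\le i\le m-1$), and edges from $x$ to exactly $x_{t_0+1},x_{t_0+t_1+1},\dots,x_{t_0+\cdots+t_{d-1}+1}$. With vertex order $x,x_1,\dots,x_m$ and $n=m+1$, a symmetric matrix $M\in M_n(\mathbb{F}_2)$ represents it if for $i\ne j$ the $(i,j)$-entry is $1$ exactly for adjacent vertices (diagonal arbitrary). $A(\Gamma)$ (resp. $B(\Gamma)$) is the number of representing matrices of rank $n$ (resp. $n-1$) whose lower-right $(n-1)\times(n-1)$ submatrix (indexed by $x_1,\dots,x_m$) has rank $n-2$. $\beta=4B-A$, and $\beta(t_0,\dots,t_d)=\beta(\Gamma(t_0,\dots,t_d))$. Here $d=5$. -}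

module Defs where

open import Data.Bool using (Bool; true; false; if_then_else_; _xor_; _∨_; _∧_)
open import Data.Nat using (ℕ; zero; suc; _+_; _≡ᵇ_)
open import Data.List using (List; []; _∷_; length; filter; map; _++_)
open import Data.Bool.ListAction using (any)
open import Data.Nat.ListAction using (sum)
open import Data.Vec using (Vec; []; _∷_; head; tail; zipWith; tabulate; toList)
open import Data.Fin using (Fin; toℕ)
open import Data.Integer using (ℤ; +_; _-_; _*_)
open import Relation.Nullary using (Dec; yes; no)
open import Relation.Binary.PropositionalEquality using (_≡_)
open import Data.Nat using (_≟_)

Matrix : ℕ → Set
Matrix n = List (Vec Bool n)

addRow : ∀ {n} → Vec Bool n → Vec Bool n → Vec Bool n
addRow = zipWith _xor_

pivotRows : ∀ {n} → Matrix (suc n) → Matrix (suc n)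
pivotRows = filter (λ v → Data.Bool._≟_ (head v) true)

zeroRows : ∀ {n} → Matrix (suc n) → Matrix (suc n)
zeroRows = filter (λ v → Data.Bool._≟_ (head v) false)

rank : (n : ℕ) → Matrix n → ℕ
rank zero     rows = 0
rank (suc n) rows with pivotRows rows
... | []      = rank n (map tail rows)
... | p ∷ ps  = suc (rank n (map tail (map (addRow p) ps ++ zeroRows rows)))

toRows : ∀ {n} → (Fin n → Fin n → Bool) → Matrix n
toRows {n} M = toList (tabulate (λ i → tabulate (λ j → M i j)))

rankSq : (n : ℕ) → (Fin n → Fin n → Bool) → ℕ
rankSq n M = rank n (toRows M)

-- The graph Γ(t₀,…,t_d), given by the list ts = t₀ ∷ … ∷ t_d.
-- Vertex 0 is x, vertex i (1 ≤ i ≤ m) is xᵢ, where m = t₀+⋯+t_d+1.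

-- indices of the neighbours of x :  t₀+1, t₀+t₁+1, …, t₀+⋯+t_{d-1}+1
nbrs : ℕ → List ℕ → List ℕ
nbrs acc []            = []
nbrs acc (t ∷ [])      = []
nbrs acc (t ∷ u ∷ rest) = suc (acc + t) ∷ nbrs (acc + t) (u ∷ rest)

xNbr : List ℕ → ℕ → Bool
xNbr ts j = any (λ a → a ≡ᵇ j) (nbrs 0 ts)

adj : List ℕ → ℕ → ℕ → Bool
adj ts zero    zero    = false
adj ts zero    (suc j) = xNbr ts (suc j)
adj ts (suc i) zero    = xNbr ts (suc i)
adj ts (suc i) (suc j) = (suc i ≡ᵇ j) ∨ (suc j ≡ᵇ i)

numVerts : List ℕ → ℕ
numVerts ts = suc (suc (sum ts))

-- The representing matrix with diagonal `dg`; every symmetric matrix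
-- representing Γ is of this form for exactly one dg : Vec Bool n.
repMatrix : (ts : List ℕ) → Vec Bool (numVerts ts) →
            Fin (numVerts ts) → Fin (numVerts ts) → Bool
repMatrix ts dg i j with toℕ i ≟ toℕ j
... | yes _ = Data.Vec.lookup dg i
... | no  _ = adj ts (toℕ i) (toℕ j)

lowerRight : ∀ {m} → (Fin (suc m) → Fin (suc m) → Bool) → Fin m → Fin m → Bool
lowerRight M i j = M (Data.Fin.suc i) (Data.Fin.suc j)

allVecs : (n : ℕ) → List (Vec Bool n)
allVecs zero    = [] ∷ []
allVecs (suc n) = map (true ∷_) (allVecs n) ++ map (false ∷_) (allVecs n)

count : ∀ {A : Set} → (A → Bool) → List A → ℕ
count P xs = length (filter (λ a → Data.Bool._≟_ (P a) true) xs)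

countRep : (ts : List ℕ) → ℕ → ℕ
countRep ts k = count good (allVecs (numVerts ts))
  where
    n = numVerts ts
    good : Vec Bool n → Bool
    good dg = (rankSq n (repMatrix ts dg) + k ≡ᵇ n)
            ∧ (rankSq (suc (sum ts)) (lowerRight (repMatrix ts dg)) ≡ᵇ sum ts)

A : List ℕ → ℕ
A ts = countRep ts 0

B : List ℕ → ℕ
B ts = countRep ts 1

β : List ℕ → ℤ
β ts = (+ 4) * (+ B ts) - (+ A ts)

{-# OPTIONS --safe #-}
-- Write a representing matrix with diagonal D₀, δ₀, …, δ_{m-1} (δᵢ at xᵢ₊₁) and let aᵢ say whether x is
-- adjacent to xᵢ₊₁. A kernel vector of the path block is determined by its first entry through the
-- recurrence e_{k+2} = e_k + δ_k e_{k+1}, so that block has corank 1 exactly when the solution u with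
-- u₀ = 0, u₁ = 1 has u_{m+1} = 0. Kernel vectors of the whole matrix with coefficient c₀ at x follow the
-- recurrence with the extra term c₀ a_k, and a discrete Wronskian shows that its solution from 0, 0 ends
-- in P = Σ u_{i+1} aᵢ when u_{m+1} = 0. Hence A = 2 #{δ : u_{m+1} = 0, P = 1} (D₀ is free) and
-- B = #{δ : u_{m+1} = 0, P = 0} (exactly one D₀ works). Reading δ one entry at a time, both counts are
-- entries of a product of 4×4 transfer matrices, `plain` at the non-neighbours of x and `joint` at its
-- neighbours, and β is twice a linear functional of that product. As plain² = plain + 2, a functional
-- positive on t and on plain t is positive on every plainᵃ t; pulling the functional back through the
-- five joints leaves 2⁶ numerical checks.
module Submission where

open import Defs
open import Data.Bool as Bool using (Bool; true; false; not; _∧_; _∨_; _xor_; if_then_else_; T)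
open import Data.Bool.ListAction using (any)
open import Data.Bool.Properties
  using ( xor-assoc; xor-comm; xor-same; xor-identityˡ; xor-identityʳ; ∧-comm; ∧-zeroʳ; ∧-identityʳ
        ; ∧-distribˡ-xor; ∨-identityʳ; not-involutive; T-∧; xor-∧-commutativeRing )
open import Data.Empty using (⊥-elim)
open import Data.Fin as Fin using (Fin; toℕ; fromℕ<)
import Data.Fin.Properties as Fin
open import Data.Integer as ℤ using (ℤ; +_; 0ℤ; -1ℤ; _>_)
import Data.Integer.Properties as ℤ
open import Data.Integer.Properties using (pos-+; pos-*)
open import Data.Integer.Tactic.RingSolver using () renaming (ring to ℤ-ring)
open import Data.List as List using (List; []; _∷_; _++_; map; filter)
import Data.List.Properties as List
open import Data.List.Membership.Propositional using (_∈_)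
open import Data.List.Membership.Propositional.Properties
  using (∈-filter⁻; ∈-filter⁺; ∈-++⁻; ∈-++⁺ˡ; ∈-++⁺ʳ; ∈-map⁻; ∈-map⁺)
open import Data.List.Relation.Binary.Permutation.Propositional using (_↭_; ↭-sym)
open import Data.List.Relation.Binary.Permutation.Propositional.Properties using (∈-resp-↭; shift)
open import Data.List.Relation.Unary.Any using (here; there)
open import Data.List.Relation.Unary.Any.Properties using (¬Any[])
open import Data.Maybe using (just; nothing)
open import Data.Nat as ℕ
  using (ℕ; zero; suc; _+_; _*_; _≤_; _<_; _≥_; z≤n; s≤s; _≡ᵇ_; compare; less; equal; greater)
import Data.Nat.Properties as ℕ
open import Data.Nat.GeneralisedArithmetic using (fold)
open import Data.Nat.ListAction using (sum)
open import Data.Product using (∃; _×_; _,_; proj₁; proj₂)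
open import Data.Sum using (_⊎_; inj₁; inj₂)
open import Data.Unit using (tt)
open import Data.Vec as Vec using (Vec; []; _∷_; head; tail; replicate; tabulate; lookup; toList)
import Data.Vec.Properties as Vec
open import Function using (_∘_; _⇔_; mk⇔; Equivalence)
open import Function.Construct.Composition using (_⇔-∘_)
open import Level using (0ℓ)
open import Relation.Binary.PropositionalEquality
open import Relation.Nullary using (¬_; Dec; yes; no)
open import Relation.Nullary.Decidable using (isYes; toWitness)
open import Tactic.RingSolver using (solve-∀)
open import Tactic.RingSolver.Core.AlmostCommutativeRing using (AlmostCommutativeRing; fromCommutativeRing)

private variable
  n r : ℕ

-- Coefficients are evaluated in Bool, so the solver also normalises x xor x to false.
xor-∧-ring : AlmostCommutativeRing 0ℓ 0ℓ
xor-∧-ring = fromCommutativeRing xor-∧-commutativeRing λ { false → just refl ; true → nothing }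

-- Linear algebra over F₂

infixl 6 _⊕_
_⊕_ : Vec Bool n → Vec Bool n → Vec Bool n
_⊕_ = addRow

0ᵛ : Vec Bool n
0ᵛ = replicate _ false

⊕-assoc : (x y z : Vec Bool n) → (x ⊕ y) ⊕ z ≡ x ⊕ (y ⊕ z)
⊕-assoc = Vec.zipWith-assoc xor-assoc

⊕-comm : (x y : Vec Bool n) → x ⊕ y ≡ y ⊕ x
⊕-comm = Vec.zipWith-comm xor-comm

⊕-identityˡ : (x : Vec Bool n) → 0ᵛ ⊕ x ≡ x
⊕-identityˡ = Vec.zipWith-identityˡ xor-identityˡ

⊕-identityʳ : (x : Vec Bool n) → x ⊕ 0ᵛ ≡ x
⊕-identityʳ = Vec.zipWith-identityʳ xor-identityʳ

⊕-self : (x : Vec Bool n) → x ⊕ x ≡ 0ᵛ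
⊕-self []      = refl
⊕-self (a ∷ x) = cong₂ _∷_ (xor-same a) (⊕-self x)

⊕-cancelˡ : (x y : Vec Bool n) → x ⊕ (x ⊕ y) ≡ y
⊕-cancelˡ x y = begin
  x ⊕ (x ⊕ y) ≡⟨ ⊕-assoc x x y ⟨
  x ⊕ x ⊕ y   ≡⟨ cong (_⊕ y) (⊕-self x) ⟩
  0ᵛ ⊕ y      ≡⟨ ⊕-identityˡ y ⟩
  y           ∎
  where open ≡-Reasoning

⊕-cancelʳ : (x y : Vec Bool n) → x ⊕ y ⊕ y ≡ x
⊕-cancelʳ x y = begin
  x ⊕ y ⊕ y   ≡⟨ ⊕-assoc x y y ⟩
  x ⊕ (y ⊕ y) ≡⟨ cong (x ⊕_) (⊕-self y) ⟩
  x ⊕ 0ᵛ      ≡⟨ ⊕-identityʳ x ⟩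
  x           ∎
  where open ≡-Reasoning

⊕-leftComm : (x y z : Vec Bool n) → x ⊕ (y ⊕ z) ≡ y ⊕ (x ⊕ z)
⊕-leftComm x y z = begin
  x ⊕ (y ⊕ z) ≡⟨ ⊕-assoc x y z ⟨
  x ⊕ y ⊕ z   ≡⟨ cong (_⊕ z) (⊕-comm x y) ⟩
  y ⊕ x ⊕ z   ≡⟨ ⊕-assoc y x z ⟩
  y ⊕ (x ⊕ z) ∎
  where open ≡-Reasoning

⊕≡0ᵛ⇒≡ : (x y : Vec Bool n) → x ⊕ y ≡ 0ᵛ → x ≡ y
⊕≡0ᵛ⇒≡ x y x⊕y≡0 = begin
  x          ≡⟨ ⊕-cancelʳ x y ⟨
  x ⊕ y ⊕ y  ≡⟨ cong (_⊕ y) x⊕y≡0 ⟩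
  0ᵛ ⊕ y     ≡⟨ ⊕-identityˡ y ⟩
  y          ∎
  where open ≡-Reasoning

head-⊕ : (x y : Vec Bool (suc n)) → head (x ⊕ y) ≡ head x xor head y
head-⊕ (a ∷ x) (b ∷ y) = refl

data Span {n} : List (Vec Bool n) → Vec Bool n → Set where
  none : Span [] 0ᵛ
  skip : ∀ {R r x} → Span R x → Span (r ∷ R) x
  take : ∀ {R r x} → Span R x → Span (r ∷ R) (r ⊕ x)

private variable
  R R' : List (Vec Bool n)

span-0ᵛ : (R : List (Vec Bool n)) → Span R 0ᵛ
span-0ᵛ []      = none
span-0ᵛ (r ∷ R) = skip (span-0ᵛ R)

span-⊕ : ∀ {x y} → Span R x → Span R y → Span R (x ⊕ y)
span-⊕ {y = y} none q = subst (Span []) (sym (⊕-identityˡ y)) q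
span-⊕ (skip p) (skip q) = skip (span-⊕ p q)
span-⊕ {R = r ∷ _} {y = y} (take {x = x} p) (skip q) =
  subst (Span _) (sym (⊕-assoc r x y)) (take (span-⊕ p q))
span-⊕ {R = r ∷ _} {x = x} (skip p) (take {x = y} q) =
  subst (Span _) (⊕-leftComm r x y) (take (span-⊕ p q))
span-⊕ {R = r ∷ _} (take {x = x} p) (take {x = y} q) =
  subst (Span _) eq (skip (span-⊕ p q))
  where
  eq : x ⊕ y ≡ r ⊕ x ⊕ (r ⊕ y)
  eq = begin
    x ⊕ y             ≡⟨ ⊕-cancelˡ r (x ⊕ y) ⟨
    r ⊕ (r ⊕ (x ⊕ y)) ≡⟨ cong (r ⊕_) (⊕-leftComm r x y) ⟩
    r ⊕ (x ⊕ (r ⊕ y)) ≡⟨ ⊕-assoc r x (r ⊕ y) ⟨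
    r ⊕ x ⊕ (r ⊕ y)   ∎
    where open ≡-Reasoning

span-closure : (P : Vec Bool n → Set) → P 0ᵛ → (∀ {x y} → P x → P y → P (x ⊕ y)) →
               (∀ {r} → r ∈ R → P r) → ∀ {x} → Span R x → P x
span-closure P P0 P⊕ PR none     = P0
span-closure P P0 P⊕ PR (skip s) = span-closure P P0 P⊕ (PR ∘ there) s
span-closure P P0 P⊕ PR (take s) = P⊕ (PR (here refl)) (span-closure P P0 P⊕ (PR ∘ there) s)

span-∈ : ∀ {r} → r ∈ R → Span R r
span-∈ {R = r ∷ R} (here refl) = subst (Span _) (⊕-identityʳ r) (take (span-0ᵛ R))
span-∈ (there r∈R)             = skip (span-∈ r∈R)

_⊆ˢ_ : List (Vec Bool n) → List (Vec Bool n) → Set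
R ⊆ˢ R' = ∀ {x} → Span R x → Span R' x

_≋_ : List (Vec Bool n) → List (Vec Bool n) → Set
R ≋ R' = R ⊆ˢ R' × R' ⊆ˢ R

span-⊆ : (∀ {r} → r ∈ R → Span R' r) → R ⊆ˢ R'
span-⊆ {R' = R'} = span-closure (Span R') (span-0ᵛ R') span-⊕

span-tail : ∀ {x} → Span R x → Span (map tail R) (tail x)
span-tail none = none
span-tail (skip s) = skip (span-tail s)
span-tail {R = (_ ∷ _) ∷ _} (take {x = _ ∷ _} s) = take (span-tail s)

span-untail : {R : List (Vec Bool (suc n))} → ∀ {y} → Span (map tail R) y →
              ∃ λ x → Span R x × tail x ≡ y
span-untail {R = []} none = 0ᵛ , none , refl
span-untail {R = r ∷ R} (skip s) with span-untail s
... | x , sx , refl = x , skip sx , refl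
span-untail {R = (a ∷ r) ∷ R} (take s) with span-untail s
... | b ∷ x , sx , refl = (a xor b) ∷ (r ⊕ x) , take sx , refl

≋-map-tail : {R R' : List (Vec Bool (suc n))} → R ≋ R' → map tail R ≋ map tail R'
≋-map-tail (R⊆R' , R'⊆R) = transport R⊆R' , transport R'⊆R
  where
  transport : ∀ {R R'} → R ⊆ˢ R' → map tail R ⊆ˢ map tail R'
  transport R⊆R' s with span-untail s
  ... | x , sx , refl = span-tail (R⊆R' sx)

≋-↭ : R ↭ R' → R ≋ R'
≋-↭ R↭R' = span-⊆ (span-∈ ∘ ∈-resp-↭ R↭R') , span-⊆ (span-∈ ∘ ∈-resp-↭ (↭-sym R↭R'))

≋-∷-⊕ : ∀ {w y} → Span R y → (w ∷ R) ≋ ((w ⊕ y) ∷ R)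
≋-∷-⊕ {R = R} {w} {y} y∈R = span-⊆ forward , span-⊆ backward
  where
  forward : ∀ {r} → r ∈ w ∷ R → Span ((w ⊕ y) ∷ R) r
  forward (here refl) = subst (Span _) (⊕-cancelʳ w y) (take y∈R)
  forward (there r∈R) = skip (span-∈ r∈R)
  backward : ∀ {r} → r ∈ (w ⊕ y) ∷ R → Span (w ∷ R) r
  backward (here refl) = take y∈R
  backward (there r∈R) = skip (span-∈ r∈R)

-- Rank by Gaussian elimination

pivot-∈ : ∀ {R : List (Vec Bool (suc n))} {p} → p ∈ pivotRows R → p ∈ R × head p ≡ true
pivot-∈ = ∈-filter⁻ (λ v → head v Bool.≟ true)

zeroRow-∈ : ∀ {R : List (Vec Bool (suc n))} {x} → x ∈ zeroRows R → x ∈ R × head x ≡ false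
zeroRow-∈ = ∈-filter⁻ (λ v → head v Bool.≟ false)

∈-pivotRows⊎zeroRows : ∀ {R : List (Vec Bool (suc n))} {x} → x ∈ R → x ∈ pivotRows R ⊎ x ∈ zeroRows R
∈-pivotRows⊎zeroRows {x = true ∷ _}  x∈R = inj₁ (∈-filter⁺ (λ v → head v Bool.≟ true) x∈R refl)
∈-pivotRows⊎zeroRows {x = false ∷ _} x∈R = inj₂ (∈-filter⁺ (λ v → head v Bool.≟ false) x∈R refl)

noPivot⇒zeroRows≡ : (R : List (Vec Bool (suc n))) → pivotRows R ≡ [] → zeroRows R ≡ R
noPivot⇒zeroRows≡ []                  _  = refl
noPivot⇒zeroRows≡ ((false ∷ x) ∷ R) e = cong ((false ∷ x) ∷_) (noPivot⇒zeroRows≡ R e)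

noPivot⇒span-head : {R : List (Vec Bool (suc n))} → pivotRows R ≡ [] → ∀ {x} → Span R x → head x ≡ false
noPivot⇒span-head {R = R} e =
  span-closure (λ x → head x ≡ false) refl (λ {x} {y} hx hy → trans (head-⊕ x y) (cong₂ _xor_ hx hy)) generator
  where
  generator : ∀ {r} → r ∈ R → head r ≡ false
  generator r∈R with ∈-pivotRows⊎zeroRows {R = R} r∈R
  ... | inj₁ r∈P = ⊥-elim (¬Any[] (subst (_ ∈_) e r∈P))
  ... | inj₂ r∈Z = proj₂ (zeroRow-∈ {R = R} r∈Z)

-- The rows on which `rank` recurses after eliminating with the pivot p (before dropping the first column).
eliminated : Vec Bool (suc n) → List (Vec Bool (suc n)) → List (Vec Bool (suc n)) → List (Vec Bool (suc n))
eliminated p ps R = map (addRow p) ps ++ zeroRows R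

module Elimination (R : List (Vec Bool (suc n))) {p ps} (pivots : pivotRows R ≡ p ∷ ps) where

  first-pivot : p ∈ R × head p ≡ true
  first-pivot = pivot-∈ (subst (p ∈_) (sym pivots) (here refl))

  generator : ∀ {r} → r ∈ eliminated p ps R → Span R r × head r ≡ false
  generator r∈E with ∈-++⁻ (map (addRow p) ps) r∈E
  ... | inj₂ r∈Z = let r∈R , hr = zeroRow-∈ r∈Z in span-∈ r∈R , hr
  ... | inj₁ r∈pP with ∈-map⁻ (addRow p) r∈pP
  ...   | q , q∈ps , refl =
    let q∈R , hq = pivot-∈ (subst (q ∈_) (sym pivots) (there q∈ps))
        p∈R , hp = first-pivot
    in span-⊕ (span-∈ p∈R) (span-∈ q∈R) , trans (head-⊕ p q) (cong₂ _xor_ hp hq)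

  span⇒ : ∀ {x} → Span (eliminated p ps R) x → Span R x × head x ≡ false
  span⇒ = span-closure (λ x → Span R x × head x ≡ false) (span-0ᵛ R , refl)
            (λ {x} {y} (sx , hx) (sy , hy) → span-⊕ sx sy , trans (head-⊕ x y) (cong₂ _xor_ hx hy))
            generator

  span⇐ : ∀ {x} → Span R x → head x ≡ false → Span (eliminated p ps R) x
  span⇐ {x} sx hx = drop-pivot (span-⊆ generate sx)
    where
    E = eliminated p ps R
    generate : ∀ {r} → r ∈ R → Span (p ∷ E) r
    generate {r} r∈R with ∈-pivotRows⊎zeroRows r∈R
    ... | inj₂ r∈Z = skip (span-∈ (∈-++⁺ʳ (map (addRow p) ps) r∈Z))
    ... | inj₁ r∈P with subst (r ∈_) pivots r∈P
    ...   | here refl = span-∈ (here refl)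
    ...   | there r∈ps = subst (Span _) (⊕-cancelˡ p r) (take (span-∈ (∈-++⁺ˡ (∈-map⁺ (addRow p) r∈ps))))
    drop-pivot : Span (p ∷ E) x → Span E x
    drop-pivot (skip s) = s
    drop-pivot (take {x = y} s) = ⊥-elim (true≢false (begin
      true                  ≡⟨ cong₂ _xor_ (proj₂ first-pivot) (proj₂ (span⇒ s)) ⟨
      head p xor head y     ≡⟨ head-⊕ p y ⟨
      head (p ⊕ y)          ≡⟨ hx ⟩
      false                 ∎))
      where open ≡-Reasoning
            true≢false : true ≢ false
            true≢false ()

rank-noPivot : (R : List (Vec Bool (suc n))) → pivotRows R ≡ [] → rank (suc n) R ≡ rank n (map tail R)
rank-noPivot R e with pivotRows R
rank-noPivot R refl | [] = refl

rank-pivot : (R : List (Vec Bool (suc n))) → ∀ {p ps} → pivotRows R ≡ p ∷ ps →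
             rank (suc n) R ≡ suc (rank n (map tail (eliminated p ps R)))
rank-pivot R e with pivotRows R
rank-pivot R refl | _ ∷ _ = refl

data Pivots (R : List (Vec Bool (suc n))) : Set where
  noPivot : pivotRows R ≡ [] → Pivots R
  pivot   : ∀ p ps → pivotRows R ≡ p ∷ ps → Pivots R

pivots : (R : List (Vec Bool (suc n))) → Pivots R
pivots R with pivotRows R in e
... | []     = noPivot e
... | p ∷ ps = pivot p ps e

pivot⇒¬⊆noPivot : (R : List (Vec Bool (suc n))) → ∀ {p ps R'} →
                  pivotRows R ≡ p ∷ ps → pivotRows R' ≡ [] → ¬ (R ⊆ˢ R')
pivot⇒¬⊆noPivot R e e' R⊆R' with Elimination.first-pivot R e
... | p∈R , hp with () ← trans (sym hp) (noPivot⇒span-head e' (R⊆R' (span-∈ p∈R)))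

rank-cong : ∀ n {R R' : List (Vec Bool n)} → R ≋ R' → rank n R ≡ rank n R'
rank-cong zero    _ = refl
rank-cong (suc n) {R} {R'} R≋R'@(R⊆R' , R'⊆R) with pivots R | pivots R'
... | noPivot e | noPivot e' = begin
  rank (suc n) R        ≡⟨ rank-noPivot R e ⟩
  rank n (map tail R)   ≡⟨ rank-cong n (≋-map-tail R≋R') ⟩
  rank n (map tail R')  ≡⟨ rank-noPivot R' e' ⟨
  rank (suc n) R'       ∎
  where open ≡-Reasoning
... | pivot _ _ e | noPivot e' = ⊥-elim (pivot⇒¬⊆noPivot R e e' R⊆R')
... | noPivot e | pivot _ _ e' = ⊥-elim (pivot⇒¬⊆noPivot R' e' e R'⊆R)
... | pivot p ps e | pivot p' ps' e' = begin
  rank (suc n) R                                  ≡⟨ rank-pivot R e ⟩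
  suc (rank n (map tail (eliminated p ps R)))     ≡⟨ cong suc (rank-cong n (≋-map-tail (E⊆E' , E'⊆E))) ⟩
  suc (rank n (map tail (eliminated p' ps' R')))  ≡⟨ rank-pivot R' e' ⟨
  rank (suc n) R'                                 ∎
  where
  open ≡-Reasoning
  module E = Elimination R e
  module E' = Elimination R' e'
  E⊆E' : eliminated p ps R ⊆ˢ eliminated p' ps' R'
  E⊆E' s = let sR , h = E.span⇒ s in E'.span⇐ (R⊆R' sR) h
  E'⊆E : eliminated p' ps' R' ⊆ˢ eliminated p ps R
  E'⊆E s = let sR' , h = E'.span⇒ s in E.span⇐ (R'⊆R sR') h

rank-∷-∈ : ∀ n {R : List (Vec Bool n)} {w} → Span R w → rank n (w ∷ R) ≡ rank n R
rank-∷-∈ n w∈R = rank-cong n (span-⊆ generator , span-⊆ (skip ∘ span-∈))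
  where
  generator : ∀ {r} → r ∈ _ ∷ _ → Span _ r
  generator (here refl) = w∈R
  generator (there r∈R) = span-∈ r∈R

untail-∉ : {E R : List (Vec Bool (suc n))} → (∀ {x} → Span E x → Span R x × head x ≡ false) →
           ∀ {w} → ¬ Span R (false ∷ w) → ¬ Span (map tail E) w
untail-∉ E⇒R w∉R s with span-untail s
... | false ∷ _ , sx , refl = w∉R (proj₁ (E⇒R sx))
... | true ∷ _  , sx , refl with () ← proj₂ (E⇒R sx)

mutual
  rank-∷-∉ : ∀ n {R : List (Vec Bool n)} {w} → ¬ Span R w → rank n (w ∷ R) ≡ suc (rank n R)
  rank-∷-∉ zero {R} {[]} w∉R = ⊥-elim (w∉R (span-0ᵛ R))
  rank-∷-∉ (suc n) {R} {false ∷ w} w∉R = rank-∷-∉-headFalse n w∉R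
  rank-∷-∉ (suc n) {R} {true ∷ w} w∉R with pivots R
  ... | noPivot e = begin
    rank (suc n) ((true ∷ w) ∷ R)            ≡⟨ rank-pivot ((true ∷ w) ∷ R) (cong ((true ∷ w) ∷_) e) ⟩
    suc (rank n (map tail (zeroRows R)))     ≡⟨ cong (suc ∘ rank n ∘ map tail) (noPivot⇒zeroRows≡ R e) ⟩
    suc (rank n (map tail R))                ≡⟨ cong suc (rank-noPivot R e) ⟨
    suc (rank (suc n) R)                     ∎
    where open ≡-Reasoning
  ... | pivot (b ∷ p') ps e with Elimination.first-pivot R e
  ...   | p∈R , refl = begin
    rank (suc n) ((true ∷ w) ∷ R)                   ≡⟨ rank-cong (suc n) (≋-∷-⊕ {w = true ∷ w} (span-∈ p∈R)) ⟩
    rank (suc n) ((false ∷ (w ⊕ p')) ∷ R)           ≡⟨ rank-∷-∉-headFalse n w⊕p∉R ⟩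
    suc (rank (suc n) R)                             ∎
    where
    open ≡-Reasoning
    w⊕p∉R : ¬ Span R (false ∷ (w ⊕ p'))
    w⊕p∉R s = w∉R (subst (Span R) (⊕-cancelʳ (true ∷ w) (true ∷ p')) (span-⊕ s (span-∈ p∈R)))

  rank-∷-∉-headFalse : ∀ n {R : List (Vec Bool (suc n))} {w} → ¬ Span R (false ∷ w) →
                       rank (suc n) ((false ∷ w) ∷ R) ≡ suc (rank (suc n) R)
  rank-∷-∉-headFalse n {R} {w} w∉R with pivots R
  ... | noPivot e = begin
    rank (suc n) ((false ∷ w) ∷ R)   ≡⟨ rank-noPivot ((false ∷ w) ∷ R) e ⟩
    rank n (w ∷ map tail R)          ≡⟨ rank-∷-∉ n (untail-∉ (λ s → s , noPivot⇒span-head e s) w∉R) ⟩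
    suc (rank n (map tail R))        ≡⟨ cong suc (rank-noPivot R e) ⟨
    suc (rank (suc n) R)             ∎
    where open ≡-Reasoning
  ... | pivot p ps e = begin
    rank (suc n) ((false ∷ w) ∷ R)                    ≡⟨ rank-pivot ((false ∷ w) ∷ R) e ⟩
    suc (rank n (map tail (map (addRow p) ps ++ (false ∷ w) ∷ zeroRows R)))
      ≡⟨ cong suc (rank-cong n (≋-map-tail (≋-↭ (shift (false ∷ w) (map (addRow p) ps) (zeroRows R))))) ⟩
    suc (rank n (w ∷ map tail (eliminated p ps R)))   ≡⟨ cong suc (rank-∷-∉ n (untail-∉ (Elimination.span⇒ R e) w∉R)) ⟩
    suc (suc (rank n (map tail (eliminated p ps R)))) ≡⟨ cong suc (rank-pivot R e) ⟨
    suc (rank (suc n) R)                              ∎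
    where open ≡-Reasoning

span? : (R : List (Vec Bool n)) (x : Vec Bool n) → Dec (Span R x)
span? [] x with Vec.≡-dec Bool._≟_ x 0ᵛ
... | yes refl = yes none
... | no x≢0   = no λ { none → x≢0 refl }
span? (r ∷ R) x with span? R x | span? R (r ⊕ x)
... | yes s | _      = yes (skip s)
... | no _  | yes s  = yes (subst (Span _) (⊕-cancelˡ r x) (take s))
... | no ¬s | no ¬s' = no λ { (skip s) → ¬s s
                            ; (take {x = y} s) → ¬s' (subst (Span R) (sym (⊕-cancelˡ r y)) s) }

rank-∷-≤ : ∀ n {R : List (Vec Bool n)} w → rank n (w ∷ R) ≤ suc (rank n R)
rank-∷-≤ n {R} w with span? R w
... | yes w∈R = ℕ.≤-trans (ℕ.≤-reflexive (rank-∷-∈ n w∈R)) (ℕ.n≤1+n _)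
... | no  w∉R = ℕ.≤-reflexive (rank-∷-∉ n w∉R)

rank-[] : ∀ n → rank n [] ≡ 0
rank-[] zero    = refl
rank-[] (suc n) = rank-[] n

-- Rank and kernel

combination : Vec (Vec Bool n) r → Vec Bool r → Vec Bool n
combination []      []          = 0ᵛ
combination (v ∷ V) (true ∷ c)  = v ⊕ combination V c
combination (v ∷ V) (false ∷ c) = combination V c

Kernel : Vec (Vec Bool n) r → Vec Bool r → Set
Kernel V c = combination V c ≡ 0ᵛ

combination∈span : (V : Vec (Vec Bool n) r) (c : Vec Bool r) → Span (toList V) (combination V c)
combination∈span []      []          = none
combination∈span (v ∷ V) (true ∷ c)  = take (combination∈span V c)
combination∈span (v ∷ V) (false ∷ c) = skip (combination∈span V c)

span⇒combination : (V : Vec (Vec Bool n) r) → ∀ {x} → Span (toList V) x → ∃ λ c → combination V c ≡ x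
span⇒combination []      none     = [] , refl
span⇒combination (v ∷ V) (skip s) = let c , eq = span⇒combination V s in false ∷ c , eq
span⇒combination (v ∷ V) (take s) = let c , eq = span⇒combination V s in true ∷ c , cong (v ⊕_) eq

combination-⊕ : (V : Vec (Vec Bool n) r) (c c' : Vec Bool r) →
                combination V (c ⊕ c') ≡ combination V c ⊕ combination V c'
combination-⊕ []      []          []           = sym (⊕-self 0ᵛ)
combination-⊕ (v ∷ V) (false ∷ c) (false ∷ c') = combination-⊕ V c c'
combination-⊕ (v ∷ V) (false ∷ c) (true ∷ c')  =
  trans (cong (v ⊕_) (combination-⊕ V c c')) (⊕-leftComm v _ _)
combination-⊕ (v ∷ V) (true ∷ c)  (false ∷ c') =
  trans (cong (v ⊕_) (combination-⊕ V c c')) (sym (⊕-assoc v _ _))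
combination-⊕ (v ∷ V) (true ∷ c)  (true ∷ c')  = begin
  combination V (c ⊕ c')                          ≡⟨ combination-⊕ V c c' ⟩
  combination V c ⊕ combination V c'              ≡⟨ ⊕-cancelˡ v _ ⟨
  v ⊕ (v ⊕ (combination V c ⊕ combination V c'))  ≡⟨ cong (v ⊕_) (⊕-leftComm v _ _) ⟩
  v ⊕ (combination V c ⊕ (v ⊕ combination V c'))  ≡⟨ ⊕-assoc v _ _ ⟨
  v ⊕ combination V c ⊕ (v ⊕ combination V c')    ∎
  where open ≡-Reasoning

kernel⇒∈span : (v : Vec Bool n) (V : Vec (Vec Bool n) r) → ∀ {c} → Kernel (v ∷ V) (true ∷ c) → Span (toList V) v
kernel⇒∈span v V {c} k = subst (Span _) (sym (⊕≡0ᵛ⇒≡ v _ k)) (combination∈span V c)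

rank≤length : (V : Vec (Vec Bool n) r) → rank n (toList V) ≤ r
rank≤length {n} []      = ℕ.≤-reflexive (rank-[] n)
rank≤length {n} (v ∷ V) = ℕ.≤-trans (rank-∷-≤ n v) (s≤s (rank≤length V))

rank≡length : (V : Vec (Vec Bool n) r) → (∀ c → Kernel V c → c ≡ 0ᵛ) → rank n (toList V) ≡ r
rank≡length {n} []      _       = rank-[] n
rank≡length {n} (v ∷ V) trivial =
  trans (rank-∷-∉ n v∉V) (cong suc (rank≡length V (λ c k → Vec.∷-injectiveʳ (trivial (false ∷ c) k))))
  where
  v∉V : ¬ Span (toList V) v
  v∉V s with span⇒combination V s
  ... | c , eq with () ← trivial (true ∷ c) (trans (cong (v ⊕_) eq) (⊕-self v))

rank<length : (V : Vec (Vec Bool n) r) → ∀ c → c ≢ 0ᵛ → Kernel V c → suc (rank n (toList V)) ≤ r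
rank<length [] [] c≢0 _ = ⊥-elim (c≢0 refl)
rank<length {n} (v ∷ V) (true ∷ c) _ k =
  ℕ.≤-trans (ℕ.≤-reflexive (cong suc (rank-∷-∈ n (kernel⇒∈span v V k)))) (s≤s (rank≤length V))
rank<length {n} (v ∷ V) (false ∷ c) c≢0 k =
  ℕ.≤-trans (s≤s (rank-∷-≤ n v)) (s≤s (rank<length V c (c≢0 ∘ cong (false ∷_)) k))

rank+1≡length : (V : Vec (Vec Bool n) r) → ∀ c → c ≢ 0ᵛ → Kernel V c →
                (∀ c' → Kernel V c' → c' ≡ 0ᵛ ⊎ c' ≡ c) → suc (rank n (toList V)) ≡ r
rank+1≡length [] [] c≢0 _ _ = ⊥-elim (c≢0 refl)
rank+1≡length {n} (v ∷ V) (true ∷ c) _ k kernel =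
  cong suc (trans (rank-∷-∈ n (kernel⇒∈span v V k)) (rank≡length V trivial))
  where
  trivial : ∀ c' → Kernel V c' → c' ≡ 0ᵛ
  trivial c' k' with kernel (false ∷ c') k'
  ... | inj₁ eq = Vec.∷-injectiveʳ eq
  ... | inj₂ ()
rank+1≡length {n} (v ∷ V) (false ∷ c) c≢0 k kernel =
  cong suc (trans (rank-∷-∉ n v∉V) (rank+1≡length V c (c≢0 ∘ cong (false ∷_)) k kernel'))
  where
  kernel' : ∀ c' → Kernel V c' → c' ≡ 0ᵛ ⊎ c' ≡ c
  kernel' c' k' with kernel (false ∷ c') k'
  ... | inj₁ eq = inj₁ (Vec.∷-injectiveʳ eq)
  ... | inj₂ eq = inj₂ (Vec.∷-injectiveʳ eq)
  v∉V : ¬ Span (toList V) v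
  v∉V s with span⇒combination V s
  ... | c' , eq with kernel (true ∷ c') (trans (cong (v ⊕_) eq) (⊕-self v))
  ...   | inj₁ ()
  ...   | inj₂ ()

rank+2≤length : (V : Vec (Vec Bool n) r) → ∀ c c' → c ≢ 0ᵛ → c' ≢ 0ᵛ → c ≢ c' →
                Kernel V c → Kernel V c' → suc (suc (rank n (toList V))) ≤ r
rank+2≤length [] [] [] c≢0 _ _ _ _ = ⊥-elim (c≢0 refl)
rank+2≤length {n} (v ∷ V) (false ∷ c) (false ∷ c') c≢0 c'≢0 c≢c' k k' =
  ℕ.≤-trans (s≤s (s≤s (rank-∷-≤ n v)))
    (s≤s (rank+2≤length V c c' (c≢0 ∘ cong (false ∷_)) (c'≢0 ∘ cong (false ∷_)) (c≢c' ∘ cong (false ∷_)) k k'))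
rank+2≤length {n} (v ∷ V) (true ∷ c) (false ∷ c') _ c'≢0 _ k k' =
  ℕ.≤-trans (ℕ.≤-reflexive (cong (suc ∘ suc) (rank-∷-∈ n (kernel⇒∈span v V k))))
    (s≤s (rank<length V c' (c'≢0 ∘ cong (false ∷_)) k'))
rank+2≤length {n} (v ∷ V) (false ∷ c) (true ∷ c') c≢0 _ _ k k' =
  ℕ.≤-trans (ℕ.≤-reflexive (cong (suc ∘ suc) (rank-∷-∈ n (kernel⇒∈span v V k'))))
    (s≤s (rank<length V c (c≢0 ∘ cong (false ∷_)) k))
rank+2≤length {n} (v ∷ V) (true ∷ c) (true ∷ c') _ _ c≢c' k k' =
  ℕ.≤-trans (ℕ.≤-reflexive (cong (suc ∘ suc) (rank-∷-∈ n (kernel⇒∈span v V k))))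
    (s≤s (rank<length V (c ⊕ c') c⊕c'≢0 k⊕k'))
  where
  k⊕k' : Kernel V (c ⊕ c')
  k⊕k' = begin
    combination V (c ⊕ c')               ≡⟨ combination-⊕ V c c' ⟩
    combination V c ⊕ combination V c'   ≡⟨ cong₂ _⊕_ (⊕≡0ᵛ⇒≡ v _ k) (⊕≡0ᵛ⇒≡ v _ k') ⟨
    v ⊕ v                                ≡⟨ ⊕-self v ⟩
    0ᵛ                                   ∎
    where open ≡-Reasoning
  c⊕c'≢0 : c ⊕ c' ≢ 0ᵛ
  c⊕c'≢0 eq = c≢c' (cong (true ∷_) (⊕≡0ᵛ⇒≡ c c' eq))

-- Xor-sums and sequences

⨁ : ℕ → (ℕ → Bool) → Bool
⨁ zero    f = false
⨁ (suc r) f = f 0 xor ⨁ r (f ∘ suc)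

syntax ⨁ r (λ i → e) = ⨁[ i < r ] e

⨁-cong : ∀ r {f g : ℕ → Bool} → (∀ i → i < r → f i ≡ g i) → ⨁ r f ≡ ⨁ r g
⨁-cong zero    _   = refl
⨁-cong (suc r) f≗g = cong₂ _xor_ (f≗g 0 (s≤s z≤n)) (⨁-cong r (λ i i<r → f≗g (suc i) (s≤s i<r)))

⨁-false : ∀ r → ⨁[ i < r ] false ≡ false
⨁-false zero    = refl
⨁-false (suc r) = ⨁-false r

⨁-xor : ∀ r (f g : ℕ → Bool) → ⨁[ i < r ] (f i xor g i) ≡ ⨁ r f xor ⨁ r g
⨁-xor zero    f g = refl
⨁-xor (suc r) f g = trans (cong ((f 0 xor g 0) xor_) (⨁-xor r (f ∘ suc) (g ∘ suc))) (interchange (f 0) (g 0) _ _)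
  where
  interchange : ∀ a b c d → (a xor b) xor (c xor d) ≡ (a xor c) xor (b xor d)
  interchange = solve-∀ xor-∧-ring

⨁-∧ˡ : ∀ r b (f : ℕ → Bool) → ⨁[ i < r ] (b ∧ f i) ≡ b ∧ ⨁ r f
⨁-∧ˡ zero    b f = sym (∧-zeroʳ b)
⨁-∧ˡ (suc r) b f = trans (cong ((b ∧ f 0) xor_) (⨁-∧ˡ r b (f ∘ suc))) (sym (∧-distribˡ-xor b (f 0) _))

⨁-snoc : ∀ r (f : ℕ → Bool) → ⨁ (suc r) f ≡ ⨁ r f xor f r
⨁-snoc zero    f = xor-identityʳ (f 0)
⨁-snoc (suc r) f = trans (cong (f 0 xor_) (⨁-snoc r (f ∘ suc))) (sym (xor-assoc (f 0) _ _))

infixl 9 _‼_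
_‼_ : Vec Bool n → ℕ → Bool
[]      ‼ _     = false
(b ∷ _) ‼ zero  = b
(_ ∷ v) ‼ suc i = v ‼ i

lookup≡‼ : (v : Vec Bool n) (i : Fin n) → lookup v i ≡ v ‼ toℕ i
lookup≡‼ (b ∷ v) Fin.zero    = refl
lookup≡‼ (b ∷ v) (Fin.suc i) = lookup≡‼ v i

‼-beyond : (v : Vec Bool n) → ∀ {i} → n ≤ i → v ‼ i ≡ false
‼-beyond []      _         = refl
‼-beyond (b ∷ v) (s≤s n≤i) = ‼-beyond v n≤i

‼-tabulate : (f : ℕ → Bool) → ∀ {i} → i < n → tabulate {n = n} (f ∘ toℕ) ‼ i ≡ f i
‼-tabulate f {zero}  (s≤s _)   = refl
‼-tabulate f {suc i} (s≤s i<n) = ‼-tabulate (f ∘ suc) i<n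

‼-ext : (x y : Vec Bool n) → (∀ i → i < n → x ‼ i ≡ y ‼ i) → x ≡ y
‼-ext []      []      _   = refl
‼-ext (a ∷ x) (b ∷ y) x≗y = cong₂ _∷_ (x≗y 0 (s≤s z≤n)) (‼-ext x y (λ i i<n → x≗y (suc i) (s≤s i<n)))

rows : (Fin r → Fin n → Bool) → Vec (Vec Bool n) r
rows M = tabulate (λ i → tabulate (M i))

lookup-combination-rows : (M : Fin r → Fin n → Bool) (M' : ℕ → ℕ → Bool) →
  (∀ i j → M i j ≡ M' (toℕ i) (toℕ j)) →
  ∀ c j → lookup (combination (rows M) c) j ≡ ⨁[ i < r ] (c ‼ i ∧ M' i (toℕ j))
lookup-combination-rows M M' M≗M' []          j = Vec.lookup-replicate j false
lookup-combination-rows M M' M≗M' (false ∷ c) j =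
  lookup-combination-rows (M ∘ Fin.suc) (M' ∘ suc) (M≗M' ∘ Fin.suc) c j
lookup-combination-rows {suc r} M M' M≗M' (true ∷ c)  j = begin
  lookup (tabulate (M Fin.zero) ⊕ combination (rows (M ∘ Fin.suc)) c) j
    ≡⟨ Vec.lookup-zipWith _xor_ j (tabulate (M Fin.zero)) (combination (rows (M ∘ Fin.suc)) c) ⟩
  lookup (tabulate (M Fin.zero)) j xor lookup (combination (rows (M ∘ Fin.suc)) c) j
    ≡⟨ cong₂ _xor_ (trans (Vec.lookup∘tabulate (M Fin.zero) j) (M≗M' Fin.zero j))
                   (lookup-combination-rows (M ∘ Fin.suc) (M' ∘ suc) (M≗M' ∘ Fin.suc) c j) ⟩
  M' 0 (toℕ j) xor ⨁[ i < r ] (c ‼ i ∧ M' (suc i) (toℕ j))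
    ∎
  where open ≡-Reasoning

≡0ᵛ⇔lookup : (x : Vec Bool n) → x ≡ 0ᵛ ⇔ (∀ j → lookup x j ≡ false)
≡0ᵛ⇔lookup x = mk⇔ (λ { refl j → Vec.lookup-replicate j false }) (to x)
  where
  to : (x : Vec Bool n) → (∀ j → lookup x j ≡ false) → x ≡ 0ᵛ
  to []      _  = refl
  to (a ∷ x) x0 = cong₂ _∷_ (x0 Fin.zero) (to x (x0 ∘ Fin.suc))

kernel⇔entries : (V : Vec (Vec Bool n) r) (c : Vec Bool r) (g : ℕ → Bool) →
          (∀ j → lookup (combination V c) j ≡ g (toℕ j)) → Kernel V c ⇔ (∀ j → j < n → g j ≡ false)
kernel⇔entries V c g entry = mk⇔
  (λ k j j<n → subst (λ i → g i ≡ false) (Fin.toℕ-fromℕ< j<n)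
                 (trans (sym (entry (fromℕ< j<n))) (Equivalence.to (≡0ᵛ⇔lookup _) k (fromℕ< j<n))))
  (λ vanish → Equivalence.from (≡0ᵛ⇔lookup _) (λ j → trans (entry j) (vanish (toℕ j) (Fin.toℕ<n j))))

∀<-suc⇔ : (g : ℕ → Bool) → (∀ j → j < suc n → g j ≡ false) ⇔ (g 0 ≡ false × (∀ j → j < n → g (suc j) ≡ false))
∀<-suc⇔ g = mk⇔ (λ all → all 0 (s≤s z≤n) , λ j j<n → all (suc j) (s≤s j<n))
                (λ { (g0 , all) zero _ → g0 ; (g0 , all) (suc j) (s≤s j<n) → all j j<n })

-- The path matrix and its three-term recurrence

-- graphMatrix ts D (suc i) (suc j) reduces to pathMatrix (D ∘ suc) i j.
pathMatrix : (ℕ → Bool) → ℕ → ℕ → Bool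
pathMatrix δ i j = if i ≡ᵇ j then δ i else (suc i ≡ᵇ j) ∨ (suc j ≡ᵇ i)

-- Entry j of the path matrix applied to (e 1, e 2, …); e 0 is a phantom zero.
threeTerm : (δ e : ℕ → Bool) → ℕ → Bool
threeTerm δ e j = e j xor δ j ∧ e (suc j) xor e (suc (suc j))

⨁-first : (c : Vec Bool r) → ⨁[ i < r ] (c ‼ i ∧ (0 ≡ᵇ i)) ≡ c ‼ 0
⨁-first []      = refl
⨁-first {suc r} (b ∷ c) = begin
  b ∧ true xor ⨁[ i < r ] (c ‼ i ∧ false)
    ≡⟨ cong₂ _xor_ (∧-identityʳ b) (trans (⨁-cong r (λ i _ → ∧-zeroʳ (c ‼ i))) (⨁-false r)) ⟩
  b xor false
    ≡⟨ xor-identityʳ b ⟩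
  b
    ∎
  where open ≡-Reasoning

pathMatrix-action : (δ : ℕ → Bool) (c : Vec Bool r) → ∀ {j} → j < r →
                    ⨁[ i < r ] (c ‼ i ∧ pathMatrix δ i j) ≡ threeTerm δ ((false ∷ c) ‼_) j
pathMatrix-action δ (b ∷ c) {zero} _ =
  cong₂ _xor_ (∧-comm b (δ 0)) (⨁-first c)
pathMatrix-action {suc r} δ (b ∷ c) {suc j} (s≤s j<r) = begin
  b ∧ ((0 ≡ᵇ j) ∨ false) xor ⨁[ i < r ] (c ‼ i ∧ pathMatrix (δ ∘ suc) i j)
    ≡⟨ cong (b ∧ ((0 ≡ᵇ j) ∨ false) xor_) (pathMatrix-action (δ ∘ suc) c j<r) ⟩
  b ∧ ((0 ≡ᵇ j) ∨ false) xor (false ∷ c) ‼ j xor rest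
    ≡⟨ xor-assoc (b ∧ ((0 ≡ᵇ j) ∨ false)) _ rest ⟨
  (b ∧ ((0 ≡ᵇ j) ∨ false) xor (false ∷ c) ‼ j) xor rest
    ≡⟨ cong (_xor rest) (previous j) ⟩
  (b ∷ c) ‼ j xor rest
    ∎
  where
  open ≡-Reasoning
  rest = δ (suc j) ∧ c ‼ j xor c ‼ suc j
  previous : ∀ j → b ∧ ((0 ≡ᵇ j) ∨ false) xor (false ∷ c) ‼ j ≡ (b ∷ c) ‼ j
  previous zero    = trans (xor-identityʳ _) (∧-identityʳ b)
  previous (suc j) = cong (_xor c ‼ j) (∧-zeroʳ b)

solution : (δ f : ℕ → Bool) → Bool → Bool → ℕ → Bool
solution δ f p q zero          = p
solution δ f p q (suc zero)    = q
solution δ f p q (suc (suc k)) = solution δ f p q k xor δ k ∧ solution δ f p q (suc k) xor f k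

residual : (δ f e : ℕ → Bool) → ℕ → Bool
residual δ f e j = f j xor threeTerm δ e j

xor≡false⇒≡ : ∀ {a b} → a xor b ≡ false → a ≡ b
xor≡false⇒≡ {false} refl = refl
xor≡false⇒≡ {true}  {true} _ = refl

solution-residual : ∀ δ f p q j → residual δ f (solution δ f p q) j ≡ false
solution-residual δ f p q j = cancel (f j) (solution δ f p q j) (δ j ∧ solution δ f p q (suc j))
  where
  cancel : ∀ x a b → x xor a xor b xor (a xor b xor x) ≡ false
  cancel = solve-∀ xor-∧-ring

residual-unique : ∀ δ f e m → (∀ j → j < m → residual δ f e j ≡ false) →
                  ∀ k → k ≤ suc m → e k ≡ solution δ f (e 0) (e 1) k
residual-unique δ f e m res zero          _ = refl
residual-unique δ f e m res (suc zero)    _ = refl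
residual-unique δ f e m res (suc (suc k)) (s≤s k<m) = begin
  e (suc (suc k))                      ≡⟨ xor≡false⇒≡ (trans (rearrange (f k) (e k) (δ k ∧ e (suc k)) _) (res k k<m)) ⟨
  e k xor δ k ∧ e (suc k) xor f k      ≡⟨ cong₂ (λ x y → x xor δ k ∧ y xor f k)
                                                (residual-unique δ f e m res k (ℕ.≤-trans (ℕ.n≤1+n k) (ℕ.m≤n⇒m≤1+n k<m)))
                                                (residual-unique δ f e m res (suc k) (ℕ.m≤n⇒m≤1+n k<m)) ⟩
  solution δ f (e 0) (e 1) (suc (suc k)) ∎
  where
  open ≡-Reasoning
  rearrange : ∀ x a b y → (a xor b xor x) xor y ≡ x xor a xor b xor y
  rearrange = solve-∀ xor-∧-ring

unitSolution : (δ : ℕ → Bool) → ℕ → Bool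
unitSolution δ = solution δ (λ _ → false) false true

forcedSolution : (δ f : ℕ → Bool) → ℕ → Bool
forcedSolution δ f = solution δ f false false

solution-split : ∀ δ f c q k →
  solution δ (λ k → c ∧ f k) false q k ≡ q ∧ unitSolution δ k xor c ∧ forcedSolution δ f k
solution-split δ f c q zero          = base₀ q c
  where
  base₀ : ∀ q c → false ≡ q ∧ false xor c ∧ false
  base₀ = solve-∀ xor-∧-ring
solution-split δ f c q (suc zero)    = base₁ q c
  where
  base₁ : ∀ q c → q ≡ q ∧ true xor c ∧ false
  base₁ = solve-∀ xor-∧-ring
solution-split δ f c q (suc (suc k)) = begin
  s k xor δ k ∧ s (suc k) xor c ∧ f k
    ≡⟨ cong₂ (λ x y → x xor δ k ∧ y xor c ∧ f k) (solution-split δ f c q k) (solution-split δ f c q (suc k)) ⟩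
  (q ∧ u k xor c ∧ w k) xor δ k ∧ (q ∧ u (suc k) xor c ∧ w (suc k)) xor c ∧ f k
    ≡⟨ linearity q c (u k) (w k) (δ k) (u (suc k)) (w (suc k)) (f k) ⟩
  q ∧ (u k xor δ k ∧ u (suc k) xor false) xor c ∧ (w k xor δ k ∧ w (suc k) xor f k)
    ∎
  where
  open ≡-Reasoning
  s = solution δ (λ k → c ∧ f k) false q
  u = unitSolution δ
  w = forcedSolution δ f
  linearity : ∀ q c uk wk d uk' wk' fk →
    (q ∧ uk xor c ∧ wk) xor d ∧ (q ∧ uk' xor c ∧ wk') xor c ∧ fk ≡
    q ∧ (uk xor d ∧ uk' xor false) xor c ∧ (wk xor d ∧ wk' xor fk)
  linearity = solve-∀ xor-∧-ring

wronskian : ∀ δ f k → let u = unitSolution δ ; w = forcedSolution δ f in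
  u k ∧ w (suc k) xor u (suc k) ∧ w k ≡ ⨁[ i < k ] (u (suc i) ∧ f i)
wronskian δ f zero    = refl
wronskian δ f (suc k) = begin
  u (suc k) ∧ (w k xor δ k ∧ w (suc k) xor f k) xor (u k xor δ k ∧ u (suc k) xor false) ∧ w (suc k)
    ≡⟨ expand (u k) (u (suc k)) (w k) (w (suc k)) (δ k) (f k) ⟩
  (u k ∧ w (suc k) xor u (suc k) ∧ w k) xor u (suc k) ∧ f k
    ≡⟨ cong (_xor u (suc k) ∧ f k) (wronskian δ f k) ⟩
  ⨁[ i < k ] (u (suc i) ∧ f i) xor u (suc k) ∧ f k
    ≡⟨ ⨁-snoc k (λ i → u (suc i) ∧ f i) ⟨
  ⨁[ i < suc k ] (u (suc i) ∧ f i)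
    ∎
  where
  open ≡-Reasoning
  u = unitSolution δ
  w = forcedSolution δ f
  expand : ∀ uk uk' wk wk' d fk →
    uk' ∧ (wk xor d ∧ wk' xor fk) xor (uk xor d ∧ uk' xor false) ∧ wk' ≡ (uk ∧ wk' xor uk' ∧ wk) xor uk' ∧ fk
  expand = solve-∀ xor-∧-ring

unitSolution-nonvanishing : ∀ δ k → unitSolution δ k ∨ unitSolution δ (suc k) ≡ true
unitSolution-nonvanishing δ zero    = refl
unitSolution-nonvanishing δ (suc k) with unitSolution δ (suc k) | unitSolution-nonvanishing δ k
... | true  | _ = refl
... | false | nonzero = begin
  u k xor δ k ∧ false xor false ≡⟨ cong (λ x → u k xor x xor false) (∧-zeroʳ (δ k)) ⟩
  u k xor false                 ≡⟨ xor-identityʳ (u k) ⟩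
  u k                           ≡⟨ ∨-identityʳ (u k) ⟨
  u k ∨ false                   ≡⟨ nonzero ⟩
  true                          ∎
  where
  open ≡-Reasoning
  u = unitSolution δ

forcedSolution-end : ∀ δ f m → unitSolution δ (suc m) ≡ false →
                     forcedSolution δ f (suc m) ≡ ⨁[ i < m ] (unitSolution δ (suc i) ∧ f i)
forcedSolution-end δ f m u-end≡0 = begin
  w (suc m)                             ≡⟨ xor-identityʳ (w (suc m)) ⟨
  true ∧ w (suc m) xor false ∧ w m      ≡⟨ cong₂ (λ a b → a ∧ w (suc m) xor b ∧ w m) u-m≡1 u-end≡0 ⟨
  u m ∧ w (suc m) xor u (suc m) ∧ w m   ≡⟨ wronskian δ f m ⟩
  ⨁[ i < m ] (u (suc i) ∧ f i)          ∎
  where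
  open ≡-Reasoning
  u = unitSolution δ
  w = forcedSolution δ f
  u-m≡1 : u m ≡ true
  u-m≡1 = trans (sym (∨-identityʳ (u m))) (trans (cong (u m ∨_) (sym u-end≡0)) (unitSolution-nonvanishing δ m))

profile : (ℕ → Bool) → Vec Bool n
profile e = tabulate (λ i → e (suc (toℕ i)))

profile-false : profile {n} (λ _ → false) ≡ 0ᵛ
profile-false {zero}  = refl
profile-false {suc n} = cong (false ∷_) profile-false

profile-cong : ∀ {e e' : ℕ → Bool} → (∀ k → e k ≡ e' k) → profile {n} e ≡ profile e'
profile-cong e≗e' = Vec.tabulate-cong (e≗e' ∘ suc ∘ toℕ)

ResidualsVanish : (δ f : ℕ → Bool) → Vec Bool n → Set
ResidualsVanish {n} δ f c = ∀ j → j < n → residual δ f ((false ∷ c) ‼_) j ≡ false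

residualsVanish⇒solution : ∀ δ f (c : Vec Bool n) → ResidualsVanish δ f c →
  let e = solution δ f false (c ‼ 0) in c ≡ profile e × e (suc n) ≡ false
residualsVanish⇒solution {n} δ f c vanish = ‼-ext c (profile e) entries , end
  where
  e = solution δ f false (c ‼ 0)
  agree : ∀ k → k ≤ suc n → (false ∷ c) ‼ k ≡ e k
  agree = residual-unique δ f ((false ∷ c) ‼_) n vanish
  entries : ∀ i → i < n → c ‼ i ≡ profile {n} e ‼ i
  entries i i<n = trans (agree (suc i) (ℕ.m≤n⇒m≤1+n i<n)) (sym (‼-tabulate (e ∘ suc) i<n))
  end : e (suc n) ≡ false
  end = trans (sym (agree (suc n) ℕ.≤-refl)) (‼-beyond c ℕ.≤-refl)

solution⇒residualsVanish : ∀ δ f q → solution δ f false q (suc n) ≡ false →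
                    ResidualsVanish {n} δ f (profile (solution δ f false q))
solution⇒residualsVanish {n} δ f q end j j<n = begin
  f j xor threeTerm δ ((false ∷ profile {n} e) ‼_) j
    ≡⟨ cong (f j xor_) (cong₃ (λ x y z → x xor δ j ∧ y xor z) (agree j (ℕ.≤-trans (ℕ.n≤1+n j) (ℕ.m≤n⇒m≤1+n j<n)))
                               (agree (suc j) (ℕ.m≤n⇒m≤1+n j<n)) (agree (suc (suc j)) (s≤s j<n))) ⟩
  residual δ f e j
    ≡⟨ solution-residual δ f false q j ⟩
  false
    ∎
  where
  open ≡-Reasoning
  e = solution δ f false q
  agree : ∀ k → k ≤ suc n → (false ∷ profile {n} e) ‼ k ≡ e k
  agree zero    _ = refl
  agree (suc k) (s≤s k≤n) with ℕ.m≤n⇒m<n∨m≡n k≤n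
  ... | inj₁ k<n  = ‼-tabulate (e ∘ suc) k<n
  ... | inj₂ refl = trans (‼-beyond (profile {n} e) ℕ.≤-refl) (sym end)
  cong₃ : ∀ (g : Bool → Bool → Bool → Bool) {x x' y y' z z'} → x ≡ x' → y ≡ y' → z ≡ z' → g x y z ≡ g x' y' z'
  cong₃ g refl refl refl = refl

-- Ranks of the representing matrices

≡ᵇ-refl : ∀ m → (m ≡ᵇ m) ≡ true
≡ᵇ-refl zero    = refl
≡ᵇ-refl (suc m) = ≡ᵇ-refl m

≢⇒≡ᵇ-false : ∀ {m n} → m ≢ n → (m ≡ᵇ n) ≡ false
≢⇒≡ᵇ-false {zero}  {zero}  0≢0   = ⊥-elim (0≢0 refl)
≢⇒≡ᵇ-false {zero}  {suc n} _     = refl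
≢⇒≡ᵇ-false {suc m} {zero}  _     = refl
≢⇒≡ᵇ-false {suc m} {suc n} sm≢sn = ≢⇒≡ᵇ-false (sm≢sn ∘ cong suc)

graphMatrix : List ℕ → (ℕ → Bool) → ℕ → ℕ → Bool
graphMatrix ts D i j = if i ≡ᵇ j then D i else adj ts i j

repMatrix≡graphMatrix : (ts : List ℕ) (dg : Vec Bool (numVerts ts)) (i j : Fin (numVerts ts)) →
                        repMatrix ts dg i j ≡ graphMatrix ts (dg ‼_) (toℕ i) (toℕ j)
repMatrix≡graphMatrix ts dg i j with toℕ i ℕ.≟ toℕ j
... | yes i≡j rewrite i≡j | ≡ᵇ-refl (toℕ j) = trans (lookup≡‼ dg i) (cong (dg ‼_) i≡j)
... | no  i≢j rewrite ≢⇒≡ᵇ-false i≢j = refl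

corank0-tests : ∀ {ρ N} → ρ ≡ N → (ρ + 0 ≡ᵇ N) ≡ true × (ρ + 1 ≡ᵇ N) ≡ false
corank0-tests {ρ} refl rewrite ℕ.+-identityʳ ρ | ℕ.+-comm ρ 1 = ≡ᵇ-refl ρ , ≢⇒≡ᵇ-false (ℕ.1+n≢n {ρ})

corank1-tests : ∀ {ρ N} → suc ρ ≡ N → (ρ + 0 ≡ᵇ N) ≡ false × (ρ + 1 ≡ᵇ N) ≡ true
corank1-tests {ρ} refl rewrite ℕ.+-identityʳ ρ | ℕ.+-comm ρ 1 = ≢⇒≡ᵇ-false (ℕ.1+n≢n {ρ} ∘ sym) , ≡ᵇ-refl (suc ρ)

corank≥2-tests : ∀ {ρ N} → suc (suc ρ) ≤ N → (ρ + 0 ≡ᵇ N) ≡ false × (ρ + 1 ≡ᵇ N) ≡ false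
corank≥2-tests {ρ} ρ+2≤N rewrite ℕ.+-identityʳ ρ | ℕ.+-comm ρ 1 =
  ≢⇒≡ᵇ-false (ℕ.<⇒≢ (ℕ.≤-trans (ℕ.n≤1+n _) ρ+2≤N)) , ≢⇒≡ᵇ-false (ℕ.<⇒≢ ρ+2≤N)

guard : ∀ {x y} b → (b ≡ false → x ≡ y) → x ∧ not b ≡ y ∧ not b
guard {x} {y} true  _   = trans (∧-zeroʳ x) (sym (∧-zeroʳ y))
guard         false x≡y = cong (_∧ true) (x≡y refl)

module Representation (ts : List ℕ) (D₀ : Bool) (d : Vec Bool (suc (sum ts))) where

  m : ℕ
  m = suc (sum ts)

  -- δ i is the diagonal entry of xᵢ₊₁ and a i says whether x is adjacent to xᵢ₊₁.
  δ : ℕ → Bool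
  δ = d ‼_

  a : ℕ → Bool
  a = xNbr ts ∘ suc

  M : Fin (suc m) → Fin (suc m) → Bool
  M = repMatrix ts (D₀ ∷ d)

  u w : ℕ → Bool
  u = unitSolution δ
  w = forcedSolution δ a

  U W P Q : Bool
  U = u (suc m)
  W = w (suc m)
  P = ⨁[ i < m ] (u (suc i) ∧ a i)
  Q = ⨁[ i < m ] (w (suc i) ∧ a i)

  σ : Bool → Bool → ℕ → Bool
  σ c₀ q k = q ∧ u k xor c₀ ∧ w k

  kernelVector : Bool → Bool → Vec Bool (suc m)
  kernelVector c₀ q = c₀ ∷ profile (σ c₀ q)

  rowZero : Bool → Vec Bool m → Bool
  rowZero c₀ c = c₀ ∧ D₀ xor ⨁[ i < m ] (c ‼ i ∧ a i)

  kernel-lowerRight⇔ : (c : Vec Bool m) → Kernel (rows (lowerRight M)) c ⇔ ResidualsVanish δ (λ k → false ∧ a k) c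
  kernel-lowerRight⇔ c = kernel⇔entries (rows (lowerRight M)) c (threeTerm δ ((false ∷ c) ‼_)) entry
    where
    entry : ∀ j → lookup (combination (rows (lowerRight M)) c) j ≡ threeTerm δ ((false ∷ c) ‼_) (toℕ j)
    entry j = trans (lookup-combination-rows (lowerRight M) (λ i j → graphMatrix ts ((D₀ ∷ d) ‼_) (suc i) (suc j))
                       (λ i j → repMatrix≡graphMatrix ts (D₀ ∷ d) (Fin.suc i) (Fin.suc j)) c j)
                    (pathMatrix-action δ c (Fin.toℕ<n j))

  kernel-M⇔ : ∀ c₀ (c : Vec Bool m) →
              Kernel (rows M) (c₀ ∷ c) ⇔ (rowZero c₀ c ≡ false × ResidualsVanish δ (λ k → c₀ ∧ a k) c)
  kernel-M⇔ c₀ c = ∀<-suc⇔ g ⇔-∘ kernel⇔entries (rows M) (c₀ ∷ c) g entry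
    where
    g : ℕ → Bool
    g zero    = rowZero c₀ c
    g (suc j) = residual δ (λ k → c₀ ∧ a k) ((false ∷ c) ‼_) j
    entry : ∀ j → lookup (combination (rows M) (c₀ ∷ c)) j ≡ g (toℕ j)
    entry j = trans (lookup-combination-rows M (graphMatrix ts ((D₀ ∷ d) ‼_)) (repMatrix≡graphMatrix ts (D₀ ∷ d))
                                             (c₀ ∷ c) j)
                    (row j)
      where
      row : ∀ (j : Fin (suc m)) → ⨁[ i < suc m ] ((c₀ ∷ c) ‼ i ∧ graphMatrix ts ((D₀ ∷ d) ‼_) i (toℕ j)) ≡ g (toℕ j)
      row Fin.zero    = refl
      row (Fin.suc j) = cong (c₀ ∧ a (toℕ j) xor_) (pathMatrix-action δ c (Fin.toℕ<n j))

  σ-solution : ∀ c₀ q k → solution δ (λ k → c₀ ∧ a k) false q k ≡ σ c₀ q k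
  σ-solution = solution-split δ a

  residualsVanish⇒σ : ∀ c₀ (c : Vec Bool m) → ResidualsVanish δ (λ k → c₀ ∧ a k) c →
                     c ≡ profile (σ c₀ (c ‼ 0)) × σ c₀ (c ‼ 0) (suc m) ≡ false
  residualsVanish⇒σ c₀ c vanish =
    let c≡ , end = residualsVanish⇒solution δ (λ k → c₀ ∧ a k) c vanish
    in trans c≡ (profile-cong (σ-solution c₀ (c ‼ 0))) , trans (sym (σ-solution c₀ (c ‼ 0) (suc m))) end

  σ⇒residualsVanish : ∀ c₀ q → σ c₀ q (suc m) ≡ false → ResidualsVanish δ (λ k → c₀ ∧ a k) (profile (σ c₀ q))
  σ⇒residualsVanish c₀ q end =
    subst (ResidualsVanish δ (λ k → c₀ ∧ a k)) (profile-cong (σ-solution c₀ q))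
          (solution⇒residualsVanish {m} δ (λ k → c₀ ∧ a k) q (trans (σ-solution c₀ q (suc m)) end))

  rowZero-σ : ∀ c₀ q → rowZero c₀ (profile (σ c₀ q)) ≡ c₀ ∧ (D₀ xor Q) xor q ∧ P
  rowZero-σ c₀ q = begin
    c₀ ∧ D₀ xor ⨁[ i < m ] (profile {m} (σ c₀ q) ‼ i ∧ a i)
      ≡⟨ cong (c₀ ∧ D₀ xor_) (⨁-cong m (λ i i<m → cong (_∧ a i) (‼-tabulate (σ c₀ q ∘ suc) i<m))) ⟩
    c₀ ∧ D₀ xor ⨁[ i < m ] ((q ∧ u (suc i) xor c₀ ∧ w (suc i)) ∧ a i)
      ≡⟨ cong (c₀ ∧ D₀ xor_) (⨁-cong m (λ i _ → distrib q c₀ (u (suc i)) (w (suc i)) (a i))) ⟩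
    c₀ ∧ D₀ xor ⨁[ i < m ] (q ∧ (u (suc i) ∧ a i) xor c₀ ∧ (w (suc i) ∧ a i))
      ≡⟨ cong (c₀ ∧ D₀ xor_) (⨁-xor m (λ i → q ∧ (u (suc i) ∧ a i)) (λ i → c₀ ∧ (w (suc i) ∧ a i))) ⟩
    c₀ ∧ D₀ xor (⨁[ i < m ] (q ∧ (u (suc i) ∧ a i)) xor ⨁[ i < m ] (c₀ ∧ (w (suc i) ∧ a i)))
      ≡⟨ cong (c₀ ∧ D₀ xor_) (cong₂ _xor_ (⨁-∧ˡ m q (λ i → u (suc i) ∧ a i)) (⨁-∧ˡ m c₀ (λ i → w (suc i) ∧ a i))) ⟩
    c₀ ∧ D₀ xor (q ∧ P xor c₀ ∧ Q)
      ≡⟨ collect c₀ D₀ q P Q ⟩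
    c₀ ∧ (D₀ xor Q) xor q ∧ P
      ∎
    where
    open ≡-Reasoning
    distrib : ∀ q c₀ x y z → (q ∧ x xor c₀ ∧ y) ∧ z ≡ q ∧ (x ∧ z) xor c₀ ∧ (y ∧ z)
    distrib = solve-∀ xor-∧-ring
    collect : ∀ c₀ D₀ q P Q → c₀ ∧ D₀ xor (q ∧ P xor c₀ ∧ Q) ≡ c₀ ∧ (D₀ xor Q) xor q ∧ P
    collect = solve-∀ xor-∧-ring

  kernel-lowerRight : ∀ c → Kernel (rows (lowerRight M)) c →
                      c ≡ profile (σ false (c ‼ 0)) × σ false (c ‼ 0) (suc m) ≡ false
  kernel-lowerRight c k = residualsVanish⇒σ false c (Equivalence.to (kernel-lowerRight⇔ c) k)

  kernel-M : ∀ c → Kernel (rows M) c →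
             ∃ λ c₀ → ∃ λ q → c ≡ kernelVector c₀ q × σ c₀ q (suc m) ≡ false × c₀ ∧ (D₀ xor Q) xor q ∧ P ≡ false
  kernel-M (c₀ ∷ c) k =
    let row0 , vanish = Equivalence.to (kernel-M⇔ c₀ c) k
        c≡ , end = residualsVanish⇒σ c₀ c vanish
    in c₀ , c ‼ 0 , cong (c₀ ∷_) c≡ , end , trans (sym (rowZero-σ c₀ (c ‼ 0))) (trans (cong (rowZero c₀) (sym c≡)) row0)

  kernelVector∈kernel : ∀ c₀ q → σ c₀ q (suc m) ≡ false → c₀ ∧ (D₀ xor Q) xor q ∧ P ≡ false →
                        Kernel (rows M) (kernelVector c₀ q)
  kernelVector∈kernel c₀ q end row0 =
    Equivalence.from (kernel-M⇔ c₀ (profile (σ c₀ q))) (trans (rowZero-σ c₀ q) row0 , σ⇒residualsVanish c₀ q end)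

  rank-lowerRight-regular : U ≡ true → rankSq m (lowerRight M) ≡ m
  rank-lowerRight-regular U≡1 = rank≡length (rows (lowerRight M)) trivial
    where
    first-zero : ∀ {q U} → U ≡ true → q ∧ U xor false ≡ false → q ≡ false
    first-zero {false} _    _ = refl
    first-zero {true}  refl ()
    trivial : ∀ c → Kernel (rows (lowerRight M)) c → c ≡ 0ᵛ
    trivial c k = let c≡ , end = kernel-lowerRight c k in
      trans c≡ (trans (cong (profile ∘ σ false) (first-zero {c ‼ 0} U≡1 end)) profile-false)

  rank-lowerRight-singular : U ≡ false → suc (rankSq m (lowerRight M)) ≡ m
  rank-lowerRight-singular U≡0 =
    rank+1≡length (rows (lowerRight M)) (profile (σ false true)) ((λ ()) ∘ cong head)
      (Equivalence.from (kernel-lowerRight⇔ (profile (σ false true)))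
                        (σ⇒residualsVanish false true (trans (xor-identityʳ U) U≡0)))
      line
    where
    line : ∀ c → Kernel (rows (lowerRight M)) c → c ≡ 0ᵛ ⊎ c ≡ profile (σ false true)
    line c k = cases (c ‼ 0) (proj₁ (kernel-lowerRight c k))
      where
      cases : ∀ q → c ≡ profile (σ false q) → c ≡ 0ᵛ ⊎ c ≡ profile (σ false true)
      cases false c≡ = inj₁ (trans c≡ profile-false)
      cases true  c≡ = inj₂ c≡

  W≡P : U ≡ false → W ≡ P
  W≡P = forcedSolution-end δ a m

  kernelVector-00 : kernelVector false false ≡ 0ᵛ
  kernelVector-00 = cong (false ∷_) profile-false

  rank-M-regular : U ≡ false → P ≡ true → rankSq (suc m) M ≡ suc m
  rank-M-regular U≡0 P≡1 = rank≡length (rows M) trivial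
    where
    only-zero : ∀ {U W P X} c₀ q → U ≡ false → W ≡ P → P ≡ true →
                q ∧ U xor c₀ ∧ W ≡ false → c₀ ∧ X xor q ∧ P ≡ false → kernelVector c₀ q ≡ 0ᵛ
    only-zero false false _    _    _    _  _  = kernelVector-00
    only-zero false true  refl refl refl _  ()
    only-zero true  false refl refl refl () _
    only-zero true  true  refl refl refl () _
    trivial : ∀ c → Kernel (rows M) c → c ≡ 0ᵛ
    trivial c k = let c₀ , q , c≡ , end , row0 = kernel-M c k in
      trans c≡ (only-zero c₀ q U≡0 (W≡P U≡0) P≡1 end row0)

  rank-M-corank1 : U ≡ false → P ≡ false → D₀ xor Q ≡ true → suc (rankSq (suc m) M) ≡ suc m
  rank-M-corank1 U≡0 P≡0 X≡1 =
    rank+1≡length (rows M) (kernelVector false true) ((λ ()) ∘ cong (head ∘ tail))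
      (kernelVector∈kernel false true (trans (xor-identityʳ U) U≡0) P≡0)
      line
    where
    line-cases : ∀ {U W P X} c₀ q → U ≡ false → W ≡ P → P ≡ false → X ≡ true →
                 q ∧ U xor c₀ ∧ W ≡ false → c₀ ∧ X xor q ∧ P ≡ false →
                 kernelVector c₀ q ≡ 0ᵛ ⊎ kernelVector c₀ q ≡ kernelVector false true
    line-cases false false _    _    _    _    _ _  = inj₁ kernelVector-00
    line-cases false true  _    _    _    _    _ _  = inj₂ refl
    line-cases true  false refl refl refl refl _ ()
    line-cases true  true  refl refl refl refl _ ()
    line : ∀ c → Kernel (rows M) c → c ≡ 0ᵛ ⊎ c ≡ kernelVector false true
    line c k with kernel-M c k
    ... | c₀ , q , refl , end , row0 = line-cases c₀ q U≡0 (W≡P U≡0) P≡0 X≡1 end row0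

  rank-M-corank2 : U ≡ false → P ≡ false → D₀ xor Q ≡ false → suc (suc (rankSq (suc m) M)) ≤ suc m
  rank-M-corank2 U≡0 P≡0 X≡0 =
    rank+2≤length (rows M) (kernelVector false true) (kernelVector true false)
      ((λ ()) ∘ cong (head ∘ tail)) ((λ ()) ∘ cong head) ((λ ()) ∘ cong head)
      (kernelVector∈kernel false true (trans (xor-identityʳ U) U≡0) P≡0)
      (kernelVector∈kernel true false (trans (W≡P U≡0) P≡0) (trans (xor-identityʳ (D₀ xor Q)) X≡0))

  lowerRight-test : (rankSq m (lowerRight M) ≡ᵇ sum ts) ≡ not U
  lowerRight-test with U in U≡
  ... | true  = trans (cong (_≡ᵇ sum ts) (rank-lowerRight-regular U≡)) (≢⇒≡ᵇ-false (ℕ.1+n≢n {sum ts}))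
  ... | false = trans (cong (_≡ᵇ sum ts) (ℕ.suc-injective (rank-lowerRight-singular U≡))) (≡ᵇ-refl (sum ts))

  M-tests : U ≡ false → (rankSq (suc m) M + 0 ≡ᵇ suc m) ≡ P × (rankSq (suc m) M + 1 ≡ᵇ suc m) ≡ not P ∧ (D₀ xor Q)
  M-tests U≡0 with P in P≡ | D₀ xor Q in X≡
  ... | true  | _     = corank0-tests (rank-M-regular U≡0 P≡)
  ... | false | true  = corank1-tests (rank-M-corank1 U≡0 P≡ X≡)
  ... | false | false = corank≥2-tests (rank-M-corank2 U≡0 P≡ X≡)

  good₀ : (rankSq (suc m) M + 0 ≡ᵇ suc m) ∧ (rankSq m (lowerRight M) ≡ᵇ sum ts) ≡ P ∧ not U
  good₀ = trans (cong ((rankSq (suc m) M + 0 ≡ᵇ suc m) ∧_) lowerRight-test) (guard U (proj₁ ∘ M-tests))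

  good₁ : (rankSq (suc m) M + 1 ≡ᵇ suc m) ∧ (rankSq m (lowerRight M) ≡ᵇ sum ts) ≡ (not P ∧ (D₀ xor Q)) ∧ not U
  good₁ = trans (cong ((rankSq (suc m) M + 1 ≡ᵇ suc m) ∧_) lowerRight-test) (guard U (proj₂ ∘ M-tests))

-- Counting diagonals with a transfer matrix

module _ {X : Set} where

  count-cong : ∀ {f g : X → Bool} xs → (∀ x → f x ≡ g x) → count f xs ≡ count g xs
  count-cong []       _ = refl
  count-cong {f} {g} (x ∷ xs) f≗g with f x | g x | f≗g x
  ... | true  | .true  | refl = cong suc (count-cong xs f≗g)
  ... | false | .false | refl = count-cong xs f≗g

  count-++ : ∀ (f : X → Bool) xs ys → count f (xs ++ ys) ≡ count f xs + count f ys
  count-++ f xs ys = trans (cong List.length (List.filter-++ (λ x → f x Bool.≟ true) xs ys))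
                           (List.length-++ (filter (λ x → f x Bool.≟ true) xs))

  count-map : ∀ {Y : Set} (f : Y → Bool) (g : X → Y) xs → count f (map g xs) ≡ count (f ∘ g) xs
  count-map f g []       = refl
  count-map f g (x ∷ xs) with f (g x)
  ... | true  = cong suc (count-map f g xs)
  ... | false = count-map f g xs

  count-xor-split : ∀ (f g : X → Bool) xs →
                    count (λ x → f x ∧ (true xor g x)) xs + count (λ x → f x ∧ (false xor g x)) xs ≡ count f xs
  count-xor-split f g []       = refl
  count-xor-split f g (x ∷ xs) with f x | g x
  ... | true  | true  = trans (ℕ.+-suc _ _) (cong suc (count-xor-split f g xs))
  ... | true  | false = cong suc (count-xor-split f g xs)
  ... | false | _     = count-xor-split f g xs

count-allVecs : ∀ k (f : Vec Bool (suc k) → Bool) →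
                count f (allVecs (suc k)) ≡ count (f ∘ (true ∷_)) (allVecs k) + count (f ∘ (false ∷_)) (allVecs k)
count-allVecs k f = trans (count-++ f (map (true ∷_) (allVecs k)) (map (false ∷_) (allVecs k)))
                          (cong₂ _+_ (count-map f (true ∷_) (allVecs k)) (count-map f (false ∷_) (allVecs k)))

record Window : Set where
  constructor ⟨_,_,_⟩
  field
    previous current parity : Bool

step : (adjacent d : Bool) → Window → Window
step adjacent d ⟨ p , c , π ⟩ = ⟨ c , p xor d ∧ c , π xor c ∧ adjacent ⟩

run : (adjacency δ : ℕ → Bool) → ℕ → Window → Window
run adjacency δ zero    s = s
run adjacency δ (suc k) s = run (adjacency ∘ suc) (δ ∘ suc) k (step (adjacency 0) (δ 0) s)

run-orbit : ∀ (adjacency δ e : ℕ → Bool) → (∀ k → e (suc (suc k)) ≡ e k xor δ k ∧ e (suc k)) →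
            ∀ k π → run adjacency δ k ⟨ e 0 , e 1 , π ⟩
                  ≡ ⟨ e k , e (suc k) , π xor ⨁[ i < k ] (e (suc i) ∧ adjacency i) ⟩
run-orbit adjacency δ e recurrence zero    π = cong (⟨ e 0 , e 1 ,_⟩) (sym (xor-identityʳ π))
run-orbit adjacency δ e recurrence (suc k) π = begin
  run (adjacency ∘ suc) (δ ∘ suc) k ⟨ e 1 , e 0 xor δ 0 ∧ e 1 , π xor e 1 ∧ adjacency 0 ⟩
    ≡⟨ cong (λ x → run (adjacency ∘ suc) (δ ∘ suc) k ⟨ e 1 , x , π xor e 1 ∧ adjacency 0 ⟩) (recurrence 0) ⟨
  run (adjacency ∘ suc) (δ ∘ suc) k ⟨ e 1 , e 2 , π xor e 1 ∧ adjacency 0 ⟩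
    ≡⟨ run-orbit (adjacency ∘ suc) (δ ∘ suc) (e ∘ suc) (recurrence ∘ suc) k _ ⟩
  ⟨ e (suc k) , e (suc (suc k)) , (π xor e 1 ∧ adjacency 0) xor ⨁[ i < k ] (e (suc (suc i)) ∧ adjacency (suc i)) ⟩
    ≡⟨ cong (⟨ e (suc k) , e (suc (suc k)) ,_⟩) (xor-assoc π _ _) ⟩
  ⟨ e (suc k) , e (suc (suc k)) , π xor ⨁[ i < suc k ] (e (suc i) ∧ adjacency i) ⟩
    ∎
  where open ≡-Reasoning

accepts : Window → Bool
accepts ⟨ _ , c , π ⟩ = not c ∧ not π

paths : (adjacency : ℕ → Bool) → ℕ → Window → ℕ
paths adjacency zero    s = if accepts s then 1 else 0
paths adjacency (suc k) s = paths (adjacency ∘ suc) k (step (adjacency 0) true s)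
                          + paths (adjacency ∘ suc) k (step (adjacency 0) false s)

count-run≡paths : ∀ adjacency k s → count (λ d → accepts (run adjacency (d ‼_) k s)) (allVecs k) ≡ paths adjacency k s
count-run≡paths adjacency zero    s with accepts s
... | true  = refl
... | false = refl
count-run≡paths adjacency (suc k) s =
  trans (count-allVecs k (λ d → accepts (run adjacency (d ‼_) (suc k) s)))
        (cong₂ _+_ (count-run≡paths (adjacency ∘ suc) k _) (count-run≡paths (adjacency ∘ suc) k _))

paths-cong : ∀ {adjacency adjacency' : ℕ → Bool} → (∀ i → adjacency i ≡ adjacency' i) →
             ∀ k s → paths adjacency k s ≡ paths adjacency' k s
paths-cong same zero    s = refl
paths-cong same (suc k) s rewrite same 0 =
  cong₂ _+_ (paths-cong (same ∘ suc) k _) (paths-cong (same ∘ suc) k _)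

paths-previous : ∀ adjacency k π → paths adjacency k ⟨ false , true , π ⟩ ≡ paths adjacency k ⟨ true , true , π ⟩
paths-previous adjacency zero    π = refl
paths-previous adjacency (suc k) π =
  ℕ.+-comm (paths (adjacency ∘ suc) k ⟨ true , true , π′ ⟩) (paths (adjacency ∘ suc) k ⟨ true , false , π′ ⟩)
  where π′ = π xor adjacency 0

record Tally : Set where
  constructor tally
  field
    even₁ even₀ odd₁ odd₀ : ℕ

tallyOf : (adjacency : ℕ → Bool) → ℕ → Tally
tallyOf adjacency k = tally (paths adjacency k ⟨ true , true , false ⟩) (paths adjacency k ⟨ true , false , false ⟩)
                            (paths adjacency k ⟨ true , true , true ⟩)  (paths adjacency k ⟨ true , false , true ⟩)

plain joint : Tally → Tally
plain (tally e₁ e₀ o₁ o₀) = tally (e₁ + e₀) (2 * e₁) (o₁ + o₀) (2 * o₁)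
joint (tally e₁ e₀ o₁ o₀) = tally (o₁ + o₀) (2 * e₁) (e₁ + e₀) (2 * o₁)

transfer : Bool → Tally → Tally
transfer false = plain
transfer true  = joint

tally-cong : ∀ {e₁ e₀ o₁ o₀ e₁' e₀' o₁' o₀'} → e₁ ≡ e₁' → e₀ ≡ e₀' → o₁ ≡ o₁' → o₀ ≡ o₀' →
             tally e₁ e₀ o₁ o₀ ≡ tally e₁' e₀' o₁' o₀'
tally-cong refl refl refl refl = refl

paths-twice : ∀ adjacency k π →
  paths adjacency k ⟨ false , true , π ⟩ + paths adjacency k ⟨ false , true , π ⟩
    ≡ 2 * paths adjacency k ⟨ true , true , π ⟩
paths-twice adjacency k π rewrite paths-previous adjacency k π = cong (_+_ x) (sym (ℕ.+-identityʳ x))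
  where x = paths adjacency k ⟨ true , true , π ⟩

tallyOf-suc : ∀ adjacency k → tallyOf adjacency (suc k) ≡ transfer (adjacency 0) (tallyOf (adjacency ∘ suc) k)
tallyOf-suc adjacency k with adjacency 0
... | false = tally-cong (ℕ.+-comm (p ⟨ true , false , false ⟩) _) (paths-twice (adjacency ∘ suc) k false)
                         (ℕ.+-comm (p ⟨ true , false , true ⟩) _) (paths-twice (adjacency ∘ suc) k true)
  where p = paths (adjacency ∘ suc) k
... | true  = tally-cong (ℕ.+-comm (p ⟨ true , false , true ⟩) _) (paths-twice (adjacency ∘ suc) k false)
                         (ℕ.+-comm (p ⟨ true , false , false ⟩) _) (paths-twice (adjacency ∘ suc) k true)
  where p = paths (adjacency ∘ suc) k

module Counting (ts : List ℕ) where

  m : ℕ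
  m = suc (sum ts)

  adjacency : ℕ → Bool
  adjacency = xNbr ts ∘ suc

  tallyΓ : Tally
  tallyΓ = tallyOf adjacency m

  -- U, P and Q do not involve the corner entry D₀, so any value of it will do here.
  module R (d : Vec Bool m) = Representation ts false d

  good₀ good₁ : Vec Bool (suc m) → Bool
  good₀ dg = (rankSq (suc m) (repMatrix ts dg) + 0 ≡ᵇ suc m) ∧ (rankSq m (lowerRight (repMatrix ts dg)) ≡ᵇ sum ts)
  good₁ dg = (rankSq (suc m) (repMatrix ts dg) + 1 ≡ᵇ suc m) ∧ (rankSq m (lowerRight (repMatrix ts dg)) ≡ᵇ sum ts)

  run-Γ : ∀ d π → run adjacency (d ‼_) m ⟨ false , true , π ⟩ ≡ ⟨ R.u d m , R.U d , π xor R.P d ⟩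
  run-Γ d = run-orbit adjacency (d ‼_) (R.u d) (λ k → cong (R.u d k xor_) (xor-identityʳ _)) m

  count≡paths : ∀ π (f : Vec Bool m → Bool) → (∀ d → f d ≡ not (R.U d) ∧ not (π xor R.P d)) →
                count f (allVecs m) ≡ paths adjacency m ⟨ true , true , π ⟩
  count≡paths π f f≗ = begin
    count f (allVecs m)
      ≡⟨ count-cong (allVecs m) (λ d → trans (f≗ d) (cong accepts (sym (run-Γ d π)))) ⟩
    count (λ d → accepts (run adjacency (d ‼_) m ⟨ false , true , π ⟩)) (allVecs m)
      ≡⟨ count-run≡paths adjacency m ⟨ false , true , π ⟩ ⟩
    paths adjacency m ⟨ false , true , π ⟩
      ≡⟨ paths-previous adjacency m π ⟩
    paths adjacency m ⟨ true , true , π ⟩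
      ∎
    where open ≡-Reasoning

  A≡ : A ts ≡ Tally.odd₁ tallyΓ + Tally.odd₁ tallyΓ
  A≡ = begin
    count good₀ (allVecs (suc m))
      ≡⟨ count-allVecs m good₀ ⟩
    count (good₀ ∘ (true ∷_)) (allVecs m) + count (good₀ ∘ (false ∷_)) (allVecs m)
      ≡⟨ cong₂ _+_ (count≡paths true _ (λ d → trans (Representation.good₀ ts true d) (odd d)))
                   (count≡paths true _ (λ d → trans (Representation.good₀ ts false d) (odd d))) ⟩
    Tally.odd₁ tallyΓ + Tally.odd₁ tallyΓ
      ∎
    where
    open ≡-Reasoning
    odd : ∀ d → R.P d ∧ not (R.U d) ≡ not (R.U d) ∧ not (not (R.P d))
    odd d = trans (∧-comm (R.P d) _) (cong (not (R.U d) ∧_) (sym (not-involutive (R.P d))))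

  B≡ : B ts ≡ Tally.even₁ tallyΓ
  B≡ = begin
    count good₁ (allVecs (suc m))
      ≡⟨ count-allVecs m good₁ ⟩
    count (good₁ ∘ (true ∷_)) (allVecs m) + count (good₁ ∘ (false ∷_)) (allVecs m)
      ≡⟨ cong₂ _+_ (count-cong (allVecs m) (λ d → trans (Representation.good₁ ts true d) (regroup d true)))
                   (count-cong (allVecs m) (λ d → trans (Representation.good₁ ts false d) (regroup d false))) ⟩
    count (λ d → F d ∧ (true xor R.Q d)) (allVecs m) + count (λ d → F d ∧ (false xor R.Q d)) (allVecs m)
      ≡⟨ count-xor-split F R.Q (allVecs m) ⟩
    count F (allVecs m)
      ≡⟨ count≡paths false F (λ d → ∧-comm (not (R.P d)) (not (R.U d))) ⟩
    Tally.even₁ tallyΓ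
      ∎
    where
    open ≡-Reasoning
    F : Vec Bool m → Bool
    F d = not (R.P d) ∧ not (R.U d)
    regroup : ∀ d b → (not (R.P d) ∧ (b xor R.Q d)) ∧ not (R.U d) ≡ F d ∧ (b xor R.Q d)
    regroup d b = ∧-interchange (not (R.P d)) (b xor R.Q d) (not (R.U d))
      where
      ∧-interchange : ∀ p x u → (p ∧ x) ∧ u ≡ (p ∧ u) ∧ x
      ∧-interchange = solve-∀ xor-∧-ring

-- Runs of non-neighbours of x

tallyOf-cong : ∀ {adjacency adjacency' : ℕ → Bool} → (∀ i → adjacency i ≡ adjacency' i) →
               ∀ k → tallyOf adjacency k ≡ tallyOf adjacency' k
tallyOf-cong same k =
  tally-cong (paths-cong same k _) (paths-cong same k _) (paths-cong same k _) (paths-cong same k _)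

-- The word 0^a₀ 1 0^a₁ 1 ⋯ 1 0^a_d, for a = a₀ and bs = a₁ ∷ ⋯ ∷ a_d.
runWord : ℕ → List ℕ → ℕ → Bool
runWord a       []       _       = false
runWord zero    (b ∷ bs) zero    = true
runWord zero    (b ∷ bs) (suc i) = runWord b bs i
runWord (suc a) (b ∷ bs) zero    = false
runWord (suc a) (b ∷ bs) (suc i) = runWord a (b ∷ bs) i

runLength : ℕ → List ℕ → ℕ
runLength a []       = a
runLength a (b ∷ bs) = a + suc (runLength b bs)

e₀ : Tally
e₀ = tally 0 1 0 0

chain : ℕ → List ℕ → Tally
chain a []       = fold e₀ plain a
chain a (b ∷ bs) = fold (joint (chain b bs)) plain a

tallyOf-silent : ∀ k → tallyOf (λ _ → false) k ≡ fold e₀ plain k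
tallyOf-silent zero    = refl
tallyOf-silent (suc k) = trans (tallyOf-suc (λ _ → false) k) (cong plain (tallyOf-silent k))

tallyOf-runWord : ∀ a bs → tallyOf (runWord a bs) (runLength a bs) ≡ chain a bs
tallyOf-runWord a []       = tallyOf-silent a
tallyOf-runWord a (b ∷ bs) = trans (leading a) (cong (λ t → fold (joint t) plain a) (tallyOf-runWord b bs))
  where
  leading : ∀ a → tallyOf (runWord a (b ∷ bs)) (a + suc (runLength b bs))
                  ≡ fold (joint (tallyOf (runWord b bs) (runLength b bs))) plain a
  leading zero    = tallyOf-suc (runWord 0 (b ∷ bs)) (runLength b bs)
  leading (suc a) = trans (tallyOf-suc (runWord (suc a) (b ∷ bs)) (a + suc (runLength b bs))) (cong plain (leading a))

-- Runs ts a bs: ts = t₀ ∷ ⋯ ∷ t_d with t₁, …, t_{d-1} ≥ 1 and run lengths a ∷ bs = t₀, t₁ - 1, …, t_{d-1} - 1, t_d.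
data Runs : List ℕ → ℕ → List ℕ → Set where
  two  : ∀ t u → Runs (t ∷ u ∷ []) t (u ∷ [])
  more : ∀ t {g u rest bs} → Runs (g ∷ u ∷ rest) g bs → Runs (t ∷ suc g ∷ u ∷ rest) t (g ∷ bs)

≡ᵇ-cancelˡ-+ : ∀ c x y → (c + x ≡ᵇ c + y) ≡ (x ≡ᵇ y)
≡ᵇ-cancelˡ-+ zero    x y = refl
≡ᵇ-cancelˡ-+ (suc c) x y = ≡ᵇ-cancelˡ-+ c x y

nbrs-above : ∀ c ts {j} → j ≤ c → any (_≡ᵇ j) (nbrs c ts) ≡ false
nbrs-above c []             _   = refl
nbrs-above c (t ∷ [])       _   = refl
nbrs-above c (t ∷ u ∷ rest) j≤c =
  cong₂ _∨_ (≢⇒≡ᵇ-false (ℕ.<⇒≢ (s≤s j≤c+t) ∘ sym)) (nbrs-above (c + t) (u ∷ rest) j≤c+t)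
  where j≤c+t = ℕ.≤-trans j≤c (ℕ.m≤m+n c t)

nbrs-suc : ∀ c g u rest → nbrs c (suc g ∷ u ∷ rest) ≡ nbrs (suc c) (g ∷ u ∷ rest)
nbrs-suc c g u rest = cong (λ z → suc z ∷ nbrs z (u ∷ rest)) (ℕ.+-suc c g)

runWord-before : ∀ t bs {i} → i < t → runWord t bs i ≡ false
runWord-before (suc t) []       _         = refl
runWord-before (suc t) (b ∷ bs) {zero}  _ = refl
runWord-before (suc t) (b ∷ bs) {suc i} (s≤s i<t) = runWord-before t (b ∷ bs) i<t

runWord-at : ∀ t b bs → runWord t (b ∷ bs) t ≡ true
runWord-at zero    b bs = refl
runWord-at (suc t) b bs = runWord-at t b bs

runWord-after : ∀ t b bs k → runWord t (b ∷ bs) (suc (t + k)) ≡ runWord b bs k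
runWord-after zero    b bs k = refl
runWord-after (suc t) b bs k = runWord-after t b bs k

runs-word : ∀ {ts a bs} → Runs ts a bs → ∀ c i → any (_≡ᵇ suc (c + i)) (nbrs c ts) ≡ runWord a bs i
runs-word (two t u) c i with compare i t
... | less .i k    = trans (cong (_∨ false) (trans (≡ᵇ-cancelˡ-+ c _ i) (≢⇒≡ᵇ-false (ℕ.m≢1+m+n i ∘ sym))))
                           (sym (runWord-before (suc (i + k)) (u ∷ []) (s≤s (ℕ.m≤m+n i k))))
... | equal .i     = trans (cong (_∨ false) (trans (≡ᵇ-cancelˡ-+ c i i) (≡ᵇ-refl i))) (sym (runWord-at i u []))
... | greater .t k = trans (cong (_∨ false) (trans (≡ᵇ-cancelˡ-+ c t _) (≢⇒≡ᵇ-false (ℕ.m≢1+m+n t))))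
                           (sym (runWord-after t u [] k))
runs-word (more t {g} {u} {rest} {bs} R) c i with compare i t
... | less .i k    = trans (cong₂ _∨_ (trans (≡ᵇ-cancelˡ-+ c _ i) (≢⇒≡ᵇ-false (ℕ.m≢1+m+n i ∘ sym)))
                                      (nbrs-above (c + suc (i + k)) (suc g ∷ u ∷ rest)
                                        (ℕ.≤-trans (ℕ.≤-reflexive (sym (ℕ.+-suc c i))) (ℕ.+-monoʳ-≤ c (s≤s (ℕ.m≤m+n i k))))))
                           (sym (runWord-before (suc (i + k)) (g ∷ bs) (s≤s (ℕ.m≤m+n i k))))
... | equal .i     = trans (cong (_∨ any (_≡ᵇ suc (c + i)) (nbrs (c + i) (suc g ∷ u ∷ rest)))
                                 (trans (≡ᵇ-cancelˡ-+ c i i) (≡ᵇ-refl i)))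
                           (sym (runWord-at i g bs))
... | greater .t k = begin
  (suc (c + t) ≡ᵇ suc (c + suc (t + k))) ∨ any (_≡ᵇ suc (c + suc (t + k))) (nbrs (c + t) (suc g ∷ u ∷ rest))
    ≡⟨ cong₂ _∨_ (trans (≡ᵇ-cancelˡ-+ c t _) (≢⇒≡ᵇ-false (ℕ.m≢1+m+n t)))
                 (cong₂ (λ j ns → any (_≡ᵇ j) ns) (cong suc reindex) (nbrs-suc (c + t) g u rest)) ⟩
  any (_≡ᵇ suc (suc (c + t) + k)) (nbrs (suc (c + t)) (g ∷ u ∷ rest))
    ≡⟨ runs-word R (suc (c + t)) k ⟩
  runWord g bs k
    ≡⟨ runWord-after t g bs k ⟨
  runWord t (g ∷ bs) (suc (t + k))
    ∎
  where
  open ≡-Reasoning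
  reindex : c + suc (t + k) ≡ suc (c + t) + k
  reindex = trans (ℕ.+-suc c (t + k)) (cong suc (sym (ℕ.+-assoc c t k)))

runs-length : ∀ {ts a bs} → Runs ts a bs → runLength a bs ≡ suc (sum ts)
runs-length (two t u) = trans (ℕ.+-suc t u) (cong (λ z → suc (t + z)) (sym (ℕ.+-identityʳ u)))
runs-length (more t {g} {u} {rest} R) = trans (cong (λ z → t + suc z) (runs-length R)) (ℕ.+-suc t _)

tallyOf-Γ : ∀ {ts a bs} → Runs ts a bs → tallyOf (xNbr ts ∘ suc) (suc (sum ts)) ≡ chain a bs
tallyOf-Γ {ts} {a} {bs} R = begin
  tallyOf (xNbr ts ∘ suc) (suc (sum ts))    ≡⟨ tallyOf-cong (runs-word R 0) (suc (sum ts)) ⟩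
  tallyOf (runWord a bs) (suc (sum ts))     ≡⟨ cong (tallyOf (runWord a bs)) (runs-length R) ⟨
  tallyOf (runWord a bs) (runLength a bs)   ≡⟨ tallyOf-runWord a bs ⟩
  chain a bs                                ∎
  where open ≡-Reasoning

-- Positivity

record Functional : Set where
  constructor functional
  field
    w₁ w₂ w₃ w₄ : ℤ

⟦_⟧ : Functional → Tally → ℤ
⟦ functional w₁ w₂ w₃ w₄ ⟧ (tally e₁ e₀ o₁ o₀) = w₁ ℤ.* + e₁ ℤ.+ w₂ ℤ.* + e₀ ℤ.+ w₃ ℤ.* + o₁ ℤ.+ w₄ ℤ.* + o₀

plainᵀ jointᵀ : Functional → Functional
plainᵀ (functional w₁ w₂ w₃ w₄) = functional (w₁ ℤ.+ + 2 ℤ.* w₂) w₁ (w₃ ℤ.+ + 2 ℤ.* w₄) w₃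
jointᵀ (functional w₁ w₂ w₃ w₄) = functional (+ 2 ℤ.* w₂ ℤ.+ w₃) w₃ (w₁ ℤ.+ + 2 ℤ.* w₄) w₁

⟦⟧-cast : ∀ w₁ w₂ w₃ w₄ {x₁ x₂ x₃ x₄ y₁ y₂ y₃ y₄} → + x₁ ≡ y₁ → + x₂ ≡ y₂ → + x₃ ≡ y₃ → + x₄ ≡ y₄ →
          ⟦ functional w₁ w₂ w₃ w₄ ⟧ (tally x₁ x₂ x₃ x₄) ≡ w₁ ℤ.* y₁ ℤ.+ w₂ ℤ.* y₂ ℤ.+ w₃ ℤ.* y₃ ℤ.+ w₄ ℤ.* y₄
⟦⟧-cast w₁ w₂ w₃ w₄ refl refl refl refl = refl

⟦⟧-plain : ∀ φ t → ⟦ φ ⟧ (plain t) ≡ ⟦ plainᵀ φ ⟧ t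
⟦⟧-plain (functional w₁ w₂ w₃ w₄) (tally e₁ e₀ o₁ o₀) =
  trans (⟦⟧-cast w₁ w₂ w₃ w₄ (pos-+ e₁ e₀) (pos-* 2 e₁) (pos-+ o₁ o₀) (pos-* 2 o₁))
        (transpose w₁ w₂ w₃ w₄ (+ e₁) (+ e₀) (+ o₁) (+ o₀))
  where
  transpose : ∀ w₁ w₂ w₃ w₄ e₁ e₀ o₁ o₀ →
    w₁ ℤ.* (e₁ ℤ.+ e₀) ℤ.+ w₂ ℤ.* (+ 2 ℤ.* e₁) ℤ.+ w₃ ℤ.* (o₁ ℤ.+ o₀) ℤ.+ w₄ ℤ.* (+ 2 ℤ.* o₁) ≡
    (w₁ ℤ.+ + 2 ℤ.* w₂) ℤ.* e₁ ℤ.+ w₁ ℤ.* e₀ ℤ.+ (w₃ ℤ.+ + 2 ℤ.* w₄) ℤ.* o₁ ℤ.+ w₃ ℤ.* o₀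
  transpose = solve-∀ ℤ-ring

⟦⟧-joint : ∀ φ t → ⟦ φ ⟧ (joint t) ≡ ⟦ jointᵀ φ ⟧ t
⟦⟧-joint (functional w₁ w₂ w₃ w₄) (tally e₁ e₀ o₁ o₀) =
  trans (⟦⟧-cast w₁ w₂ w₃ w₄ (pos-+ o₁ o₀) (pos-* 2 e₁) (pos-+ e₁ e₀) (pos-* 2 o₁))
        (transpose w₁ w₂ w₃ w₄ (+ e₁) (+ e₀) (+ o₁) (+ o₀))
  where
  transpose : ∀ w₁ w₂ w₃ w₄ e₁ e₀ o₁ o₀ →
    w₁ ℤ.* (o₁ ℤ.+ o₀) ℤ.+ w₂ ℤ.* (+ 2 ℤ.* e₁) ℤ.+ w₃ ℤ.* (e₁ ℤ.+ e₀) ℤ.+ w₄ ℤ.* (+ 2 ℤ.* o₁) ≡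
    (+ 2 ℤ.* w₂ ℤ.+ w₃) ℤ.* e₁ ℤ.+ w₃ ℤ.* e₀ ℤ.+ (w₁ ℤ.+ + 2 ℤ.* w₄) ℤ.* o₁ ℤ.+ w₁ ℤ.* o₀
  transpose = solve-∀ ℤ-ring

⟦⟧-plain² : ∀ φ t → ⟦ φ ⟧ (plain (plain t)) ≡ ⟦ φ ⟧ (plain t) ℤ.+ + 2 ℤ.* ⟦ φ ⟧ t
⟦⟧-plain² φ@(functional w₁ w₂ w₃ w₄) t@(tally e₁ e₀ o₁ o₀) = begin
  ⟦ φ ⟧ (plain (plain t))                        ≡⟨ trans (⟦⟧-plain φ (plain t)) (⟦⟧-plain (plainᵀ φ) t) ⟩
  ⟦ plainᵀ (plainᵀ φ) ⟧ t                         ≡⟨ cayley w₁ w₂ w₃ w₄ (+ e₁) (+ e₀) (+ o₁) (+ o₀) ⟩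
  ⟦ plainᵀ φ ⟧ t ℤ.+ + 2 ℤ.* ⟦ φ ⟧ t             ≡⟨ cong (ℤ._+ + 2 ℤ.* ⟦ φ ⟧ t) (⟦⟧-plain φ t) ⟨
  ⟦ φ ⟧ (plain t) ℤ.+ + 2 ℤ.* ⟦ φ ⟧ t            ∎
  where
  open ≡-Reasoning
  cayley : ∀ w₁ w₂ w₃ w₄ e₁ e₀ o₁ o₀ →
    ((w₁ ℤ.+ + 2 ℤ.* w₂) ℤ.+ + 2 ℤ.* w₁) ℤ.* e₁ ℤ.+ (w₁ ℤ.+ + 2 ℤ.* w₂) ℤ.* e₀
      ℤ.+ ((w₃ ℤ.+ + 2 ℤ.* w₄) ℤ.+ + 2 ℤ.* w₃) ℤ.* o₁ ℤ.+ (w₃ ℤ.+ + 2 ℤ.* w₄) ℤ.* o₀ ≡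
    ((w₁ ℤ.+ + 2 ℤ.* w₂) ℤ.* e₁ ℤ.+ w₁ ℤ.* e₀ ℤ.+ (w₃ ℤ.+ + 2 ℤ.* w₄) ℤ.* o₁ ℤ.+ w₃ ℤ.* o₀)
      ℤ.+ + 2 ℤ.* (w₁ ℤ.* e₁ ℤ.+ w₂ ℤ.* e₀ ℤ.+ w₃ ℤ.* o₁ ℤ.+ w₄ ℤ.* o₀)
  cayley = solve-∀ ℤ-ring

fold-plain-positive : ∀ φ t → 0ℤ ℤ.< ⟦ φ ⟧ t → 0ℤ ℤ.< ⟦ φ ⟧ (plain t) → ∀ a → 0ℤ ℤ.< ⟦ φ ⟧ (fold t plain a)
fold-plain-positive φ t pos₀ pos₁ a = proj₁ (consecutive a)
  where
  consecutive : ∀ a → 0ℤ ℤ.< ⟦ φ ⟧ (fold t plain a) × 0ℤ ℤ.< ⟦ φ ⟧ (fold t plain (suc a))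
  consecutive zero    = pos₀ , pos₁
  consecutive (suc a) =
    let pos , pos′ = consecutive a in
    pos′ , subst (0ℤ ℤ.<_) (sym (⟦⟧-plain² φ (fold t plain a))) (ℤ.+-mono-< pos′ (ℤ.*-monoˡ-<-pos (+ 2) pos))

positive? : ℤ → Bool
positive? x = isYes (0ℤ ℤ.<? x)

positive?-sound : ∀ x → T (positive? x) → 0ℤ ℤ.< x
positive?-sound x = toWitness {a? = 0ℤ ℤ.<? x}

certified : ℕ → Functional → Bool
certified zero    φ = positive? (⟦ φ ⟧ e₀) ∧ positive? (⟦ φ ⟧ (plain e₀))
certified (suc d) φ = certified d (jointᵀ φ) ∧ certified d (jointᵀ (plainᵀ φ))

certified-sound : ∀ φ a bs → T (certified (List.length bs) φ) → 0ℤ ℤ.< ⟦ φ ⟧ (chain a bs)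
certified-sound φ a [] ok =
  let ok₀ , ok₁ = Equivalence.to (T-∧ {positive? (⟦ φ ⟧ e₀)}) ok in
  fold-plain-positive φ e₀ (positive?-sound _ ok₀) (positive?-sound _ ok₁) a
certified-sound φ a (b ∷ bs) ok =
  let ok₀ , ok₁ = Equivalence.to (T-∧ {certified (List.length bs) (jointᵀ φ)}) ok in
  fold-plain-positive φ (joint (chain b bs))
    (subst (0ℤ ℤ.<_) (sym (⟦⟧-joint φ _)) (certified-sound (jointᵀ φ) b bs ok₀))
    (subst (0ℤ ℤ.<_) (sym (trans (⟦⟧-plain φ _) (⟦⟧-joint (plainᵀ φ) _)))
           (certified-sound (jointᵀ (plainᵀ φ)) b bs ok₁))
    a

w★ : Functional
w★ = functional (+ 2) 0ℤ -1ℤ 0ℤ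

β≡2⟦w★⟧ : ∀ ts → β ts ≡ + 2 ℤ.* ⟦ w★ ⟧ (Counting.tallyΓ ts)
β≡2⟦w★⟧ ts = begin
  + 4 ℤ.* + B ts ℤ.- + A ts              ≡⟨ cong₂ (λ b a → + 4 ℤ.* + b ℤ.- + a) (Counting.B≡ ts) (Counting.A≡ ts) ⟩
  + 4 ℤ.* + e₁ ℤ.- + (o₁ + o₁)           ≡⟨ cong (λ z → + 4 ℤ.* + e₁ ℤ.- z) (pos-+ o₁ o₁) ⟩
  + 4 ℤ.* + e₁ ℤ.- (+ o₁ ℤ.+ + o₁)       ≡⟨ rearrange (+ e₁) (+ Tally.even₀ t) (+ o₁) (+ Tally.odd₀ t) ⟩
  + 2 ℤ.* ⟦ w★ ⟧ t                        ∎
  where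
  open ≡-Reasoning
  t = Counting.tallyΓ ts
  e₁ = Tally.even₁ t
  o₁ = Tally.odd₁ t
  rearrange : ∀ e₁ e₀ o₁ o₀ →
    + 4 ℤ.* e₁ ℤ.- (o₁ ℤ.+ o₁) ≡ + 2 ℤ.* (+ 2 ℤ.* e₁ ℤ.+ 0ℤ ℤ.* e₀ ℤ.+ -1ℤ ℤ.* o₁ ℤ.+ 0ℤ ℤ.* o₀)
  rearrange = solve-∀ ℤ-ring

β-positive : ∀ {ts a bs} → Runs ts a bs → T (certified (List.length bs) w★) → β ts > 0ℤ
β-positive {ts} {a} {bs} runs ok =
  subst (0ℤ ℤ.<_) (sym (β≡2⟦w★⟧ ts))
    (ℤ.*-monoˡ-<-pos (+ 2) (subst (λ t → 0ℤ ℤ.< ⟦ w★ ⟧ t) (sym (tallyOf-Γ runs)) (certified-sound w★ a bs ok)))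

mainTheorem19 : (k p q r s t : ℕ) → p ≥ 1 → q ≥ 1 → r ≥ 1 → s ≥ 1 →
    β (k ∷ p ∷ q ∷ r ∷ s ∷ t ∷ []) > + 0
mainTheorem19 k (suc p) (suc q) (suc r) (suc s) t (s≤s _) (s≤s _) (s≤s _) (s≤s _) =
  β-positive (more k (more p (more q (more r (two s t))))) tt
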